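{- (i) $\tilde{S}\circ S=S\circ\tilde{S}=\mathrm{id}$ on $\mathfrak{H}^1$. (ii) For all $w_1,w_2\in\mathfrak{H}^1$, \[ \tilde{S}(w_1*w_2)=\tilde{S}(w_1)\,\overline{*}\,\tilde{S}(w_2)\quad\text{and}\quad \tilde{S}(w_1\sqcup\!\!\sqcup w_2)=\tilde{S}(w_1)\,\overline{\sqcup\!\!\sqcup}\,\tilde{S}(w_2). \]
   Context: Let $\mathfrak{H}=\mathbb{Q}\langle x,y\rangle$ be the noncommutative polynomial ring in $x,y$, $\mathfrak{H}^1=\mathbb{Q}+\mathfrak{H}y$, and $z_k=x^{k-1}y$ ($k\ge1$). Let $S_1$ be the $\mathbb{Q}$-algebra automorphism of $\mathfrak{H}$ with $S_1(x)=x$, $S_1(y)=x+y$, and $S:\mathfrak{H}^1\to\mathfrak{H}^1$ the $\mathbb{Q}$-linear map with $S(1)=1$, $S(Fy)=S_1(F)y$ for every word $F\in\mathfrak{H}$. Let $S_2$ be the $\mathbb{Q}$-algebra endomorphism of $\mathfrak{H}$ with $S_2(1)=1$, $S_2(x)=x$, $S_2(y)=y-x$, and $\tilde{S}:\mathfrak{H}^1\to\mathfrak{H}^1$ the $\mathbb{Q}$-linear map with $\tilde{S}(1)=1$, $\tilde{S}(Fy)=S_2(F)y$ for every word $F\in\mathfrak{H}$. Harmonic product $*$ on $\mathfrak{H}^1$: $\mathbb{Q}$-bilinear, $1*w=w*1=w$, $z_kw_1*z_lw_2=z_k(w_1*z_lw_2)+z_l(z_kw_1*w_2)+z_{k+l}(w_1*w_2)$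 for words $w,w_1,w_2\in\mathfrak{H}^1$. n-harmonic product $\overline{*}$ on $\mathfrak{H}^1$: same but with $-z_{k+l}(w_1\,\overline{*}\,w_2)$ in place of $+z_{k+l}(w_1*w_2)$ (and $\overline{*}$ throughout). Shuffle product $\sqcup\!\!\sqcup$ on $\mathfrak{H}$: $\mathbb{Q}$-bilinear, $1\sqcup\!\!\sqcup w=w\sqcup\!\!\sqcup 1=w$, $u_1w_1\sqcup\!\!\sqcup u_2w_2=u_1(w_1\sqcup\!\!\sqcup u_2w_2)+u_2(u_1w_1\sqcup\!\!\sqcup w_2)$ for $u_1,u_2\in\{x,y\}$ and words $w,w_1,w_2\in\mathfrak{H}$. n-shuffle product $\overline{\sqcup\!\!\sqcup}$ on $\mathfrak{H}$: $\mathbb{Q}$-bilinear, $1\,\overline{\sqcup\!\!\sqcup}\,w=w\,\overline{\sqcup\!\!\sqcup}\,1=w$, $u_1w_1\,\overline{\sqcup\!\!\sqcup}\,u_2w_2=u_1(w_1\,\overline{\sqcup\!\!\sqcup}\,u_2w_2)+u_2(u_1w_1\,\overline{\sqcup\!\!\sqcup}\,w_2)-\delta(w_1)\tau(u_1)u_2w_2-\delta(w_2)\tau(u_2)u_1w_1$, where $\delta(w)=1$ if $w=1$ and $0$ otherwise, and $\tau(x)=y$, $\tau(y)=x$. -}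

module Defs where

open import Data.Nat using (ℕ; zero; suc)
open import Data.Rational using (ℚ; 0ℚ; 1ℚ; -_) renaming (_+_ to _+ℚ_; _*_ to _*ℚ_)
open import Data.List using (List; []; _∷_; _++_; map; replicate; concatMap)
open import Data.Maybe using (Maybe; just; nothing)
open import Data.Product using (_×_; _,_; ∃)
open import Data.Sum using (_⊎_)
open import Relation.Nullary using (¬_; yes; no)
open import Relation.Binary.PropositionalEquality using (_≡_; _≢_)
import Data.List.Properties as LP

data Letter : Set where
  𝕩 𝕪 : Letter

_≟L_ : (a b : Letter) → Relation.Nullary.Dec (a ≡ b)
𝕩 ≟L 𝕩 = yes _≡_.refl
𝕩 ≟L 𝕪 = no (λ ())
𝕪 ≟L 𝕩 = no (λ ())
𝕪 ≟L 𝕪 = yes _≡_.refl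

Word : Set
Word = List Letter

_≟W_ : (u v : Word) → Relation.Nullary.Dec (u ≡ v)
_≟W_ = LP.≡-dec _≟L_

-- Formal finite ℚ-linear combinations (elements of 𝔥 when A = Word)

FS : Set → Set
FS A = List (ℚ × A)

Poly : Set
Poly = FS Word

coeff : Poly → Word → ℚ
coeff [] w = 0ℚ
coeff ((c , v) ∷ p) w with v ≟W w
... | yes _ = c +ℚ coeff p w
... | no  _ = coeff p w

infix 4 _≈_
_≈_ : Poly → Poly → Set
p ≈ q = ∀ w → coeff p w ≡ coeff q w

scale : {A : Set} → ℚ → FS A → FS A
scale c = map (λ { (d , w) → (c *ℚ d , w) })

mapFS : {A B : Set} → (A → B) → FS A → FS B
mapFS f = map (λ { (d , w) → (d , f w) })

lin : {A B : Set} → (A → FS B) → FS A → FS B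
lin f [] = []
lin f ((c , w) ∷ p) = scale c (f w) ++ lin f p

bilin : {A B C : Set} → (A → B → FS C) → FS A → FS B → FS C
bilin f p q = lin (λ u → lin (λ v → f u v) q) p

lmul : Letter → Poly → Poly
lmul a = mapFS (a ∷_)

rmulY : Poly → Poly
rmulY = mapFS (_++ (𝕪 ∷ []))

H1Word : Word → Set
H1Word w = w ≡ [] ⊎ ∃ (λ F → w ≡ F ++ (𝕪 ∷ []))

InH1 : Poly → Set
InH1 p = ∀ w → ¬ (coeff p w ≡ 0ℚ) → H1Word w

-- S₁ (automorphism x ↦ x, y ↦ x + y), S₂ (endomorphism x ↦ x, y ↦ y - x)
-- on words

S₁w : Word → Poly
S₁w [] = (1ℚ , []) ∷ []
S₁w (𝕩 ∷ w) = lmul 𝕩 (S₁w w)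
S₁w (𝕪 ∷ w) = lmul 𝕩 (S₁w w) ++ lmul 𝕪 (S₁w w)

S₂w : Word → Poly
S₂w [] = (1ℚ , []) ∷ []
S₂w (𝕩 ∷ w) = lmul 𝕩 (S₂w w)
S₂w (𝕪 ∷ w) = lmul 𝕪 (S₂w w) ++ scale (- 1ℚ) (lmul 𝕩 (S₂w w))

dropLastY : Word → Maybe Word
dropLastY [] = nothing
dropLastY (𝕩 ∷ []) = nothing
dropLastY (𝕪 ∷ []) = just []
dropLastY (a ∷ w@(_ ∷ _)) with dropLastY w
... | just F = just (a ∷ F)
... | nothing = nothing

-- S and S̃ on words of 𝔥¹ (words not in 𝔥¹ are sent to 0; they never
-- occur since the maps are only applied to elements of 𝔥¹)
Sw : Word → Poly
Sw [] = (1ℚ , []) ∷ []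
Sw w@(_ ∷ _) with dropLastY w
... | just F = rmulY (S₁w F)
... | nothing = []

S̃w : Word → Poly
S̃w [] = (1ℚ , []) ∷ []
S̃w w@(_ ∷ _) with dropLastY w
... | just F = rmulY (S₂w F)
... | nothing = []

S : Poly → Poly
S = lin Sw

S̃ : Poly → Poly
S̃ = lin S̃w

-- Words of 𝔥¹ as sequences of z's: the entry m stands for z_{m+1} = x^m y

parseZ : ℕ → Word → Maybe (List ℕ)
parseZ zero [] = just []
parseZ (suc _) [] = nothing
parseZ n (𝕩 ∷ w) = parseZ (suc n) w
parseZ n (𝕪 ∷ w) with parseZ zero w
... | just l = just (n ∷ l)
... | nothing = nothing

zWord : List ℕ → Word
zWord [] = []
zWord (m ∷ l) = replicate m 𝕩 ++ (𝕪 ∷ zWord l)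

-- harmonic product on z-sequences: z_{m+1} z_{n+1} ↦ z_{m+n+2} = index m+n+1
harZ : List ℕ → List ℕ → FS (List ℕ)
harZ [] v = (1ℚ , v) ∷ []
harZ u@(_ ∷ _) [] = (1ℚ , u) ∷ []
harZ (a ∷ u) (b ∷ v) =
  mapFS (a ∷_) (harZ u (b ∷ v)) ++
  mapFS (b ∷_) (harZ (a ∷ u) v) ++
  mapFS (suc (a Data.Nat.+ b) ∷_) (harZ u v)

nharZ : List ℕ → List ℕ → FS (List ℕ)
nharZ [] v = (1ℚ , v) ∷ []
nharZ u@(_ ∷ _) [] = (1ℚ , u) ∷ []
nharZ (a ∷ u) (b ∷ v) =
  mapFS (a ∷_) (nharZ u (b ∷ v)) ++
  mapFS (b ∷_) (nharZ (a ∷ u) v) ++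
  scale (- 1ℚ) (mapFS (suc (a Data.Nat.+ b) ∷_) (nharZ u v))

-- lift a product of z-sequences to words of 𝔥¹ (0 outside 𝔥¹)
liftZ : (List ℕ → List ℕ → FS (List ℕ)) → Word → Word → Poly
liftZ f u v with parseZ zero u | parseZ zero v
... | just l | just m = mapFS zWord (f l m)
... | _ | _ = []

infixl 7 _✶_ _✶̄_ _⧢_ _⧢̄_

_✶_ : Poly → Poly → Poly
_✶_ = bilin (liftZ harZ)

_✶̄_ : Poly → Poly → Poly
_✶̄_ = bilin (liftZ nharZ)

shw : Word → Word → Poly
shw [] v = (1ℚ , v) ∷ []
shw u@(_ ∷ _) [] = (1ℚ , u) ∷ []
shw (a ∷ u) (b ∷ v) = lmul a (shw u (b ∷ v)) ++ lmul b (shw (a ∷ u) v)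

τ : Letter → Letter
τ 𝕩 = 𝕪
τ 𝕪 = 𝕩

-- the correction term  − δ(w₁) τ(u₁) w  (w₁ is the tail after u₁)
corr : Word → Letter → Word → Poly
corr [] a w = (- 1ℚ , τ a ∷ w) ∷ []
corr (_ ∷ _) a w = []

nshw : Word → Word → Poly
nshw [] v = (1ℚ , v) ∷ []
nshw u@(_ ∷ _) [] = (1ℚ , u) ∷ []
nshw (a ∷ u) (b ∷ v) =
  lmul a (nshw u (b ∷ v)) ++ lmul b (nshw (a ∷ u) v) ++
  corr u a (b ∷ v) ++ corr v b (a ∷ u)

_⧢_ : Poly → Poly → Poly
_⧢_ = bilin shw

_⧢̄_ : Poly → Poly → Poly
_⧢̄_ = bilin nshw

module Submission where

-- We mostly use the
-- finer relation p ≐ q: "ev p g ≡ ev q g for every functional g".  It implies _≈_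
-- and is a congruence for lin, bilin and mapFS, which have adjoints on functionals
-- (record Linear); linear identities are checked by the ring solver (lin-comb).
-- The hypothesis p ∈ 𝔥¹ enters only through ev-support, which reduces every
-- statement to single words of 𝔥¹ (lin-on-H1, bilin-on-H1).
--
-- (i) follows from S₂ ∘ S₁ = S₁ ∘ S₂ = id, as S (F y) = S₁(F) y and S̃ (F y) = S₂(F) y.
-- (ii) S̃ (a w) = θ_a (S̃ w), θ_a being left multiplication by S₂(a).  The lemma
-- leibniz-extend carries a Leibniz rule from single operators to formal combinations
-- of them: from letters to S₂(a) for ⧢̄, and from "prefix z_a" and "merge z_a into the
-- first letter" to their difference, which is how S̃ acts on z-words, for ✶̄.

open import Defs
open import Data.Product using (_×_; _,_; ∃)
open import Data.Nat as ℕ using (ℕ; zero; suc)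
import Data.Nat.Properties as ℕP
open import Data.Rational using (ℚ; 0ℚ; 1ℚ; -_; _+_; _*_)
open import Data.Rational.Properties as ℚP using (+-*-commutativeRing; _≟_)
open import Data.Rational.Solver using (module +-*-Solver)
open import Data.List using (List; []; _∷_; _++_; length; replicate)
import Data.List.Properties as ListP
open import Data.Vec as Vec using (Vec; []; _∷_; lookup)
open import Data.Vec.Properties using (lookup-map)
open import Data.Fin using (Fin; #_)
open import Data.Maybe using (just; nothing)
open import Data.Sum using (inj₁; inj₂)
open import Data.Empty using (⊥-elim)
open import Level using (0ℓ)
open import Relation.Nullary using (Dec; yes; no)
open import Relation.Nullary.Decidable.Core using (True; dec⇒maybe)
open import Relation.Binary.PropositionalEquality
open import Relation.Binary.Bundles using (Setoid)
import Relation.Binary.Reasoning.Setoid as SetoidReasoning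
import Tactic.RingSolver.Core.AlmostCommutativeRing as ACR
open import Tactic.RingSolver using (solve-∀)
open +-*-Solver using (Polynomial; _:+_; :-_; con; ⟦_⟧↓; correct)
  renaming (var to ⟨_⟩; ⟦_⟧ to ⟦_⟧ℚ)

ℚ-ring : ACR.AlmostCommutativeRing 0ℓ 0ℓ
ℚ-ring = ACR.fromCommutativeRing +-*-commutativeRing (λ x → dec⇒maybe (0ℚ ≟ x))

ev : {A : Set} → FS A → (A → ℚ) → ℚ
ev [] g = 0ℚ
ev ((c , v) ∷ p) g = c * g v + ev p g

sing : {A : Set} → A → FS A
sing v = (1ℚ , v) ∷ []

neg : {A : Set} → FS A → FS A
neg = scale (- 1ℚ)

module _ {A : Set} where

  ev-++ : (p q : FS A) (g : A → ℚ) → ev (p ++ q) g ≡ ev p g + ev q g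
  ev-++ [] q g = sym (ℚP.+-identityˡ (ev q g))
  ev-++ ((c , v) ∷ p) q g =
    trans (cong (c * g v +_) (ev-++ p q g)) (assoc (c * g v) (ev p g) (ev q g))
    where assoc : ∀ x y z → x + (y + z) ≡ (x + y) + z
          assoc = solve-∀ ℚ-ring

  ev-scale : (k : ℚ) (p : FS A) (g : A → ℚ) → ev (scale k p) g ≡ k * ev p g
  ev-scale k [] g = sym (ℚP.*-zeroʳ k)
  ev-scale k ((c , v) ∷ p) g =
    trans (cong (k * c * g v +_) (ev-scale k p g)) (distrib k c (g v) (ev p g))
    where distrib : ∀ k c x e → k * c * x + k * e ≡ k * (c * x + e)
          distrib = solve-∀ ℚ-ring

  ev-neg : (p : FS A) (g : A → ℚ) → ev (neg p) g ≡ - ev p g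
  ev-neg p g = trans (ev-scale (- 1ℚ) p g) (minus-one (ev p g))
    where minus-one : ∀ x → - 1ℚ * x ≡ - x
          minus-one = solve-∀ ℚ-ring

  ev-cong : (p : FS A) {g h : A → ℚ} → (∀ v → g v ≡ h v) → ev p g ≡ ev p h
  ev-cong [] e = refl
  ev-cong ((c , v) ∷ p) e = cong₂ (λ x y → c * x + y) (e v) (ev-cong p e)

  ev-+ : (p : FS A) (g h : A → ℚ) → ev p (λ v → g v + h v) ≡ ev p g + ev p h
  ev-+ [] g h = refl
  ev-+ ((c , v) ∷ p) g h =
    trans (cong (c * (g v + h v) +_) (ev-+ p g h)) (shuffle c (g v) (h v) (ev p g) (ev p h))
    where shuffle : ∀ c x y e f → c * (x + y) + (e + f) ≡ (c * x + e) + (c * y + f)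
          shuffle = solve-∀ ℚ-ring

  ev-* : (p : FS A) (k : ℚ) (g : A → ℚ) → ev p (λ v → k * g v) ≡ k * ev p g
  ev-* [] k g = sym (ℚP.*-zeroʳ k)
  ev-* ((c , v) ∷ p) k g =
    trans (cong (c * (k * g v) +_) (ev-* p k g)) (distrib c k (g v) (ev p g))
    where distrib : ∀ c k x e → c * (k * x) + k * e ≡ k * (c * x + e)
          distrib = solve-∀ ℚ-ring

  ev-0 : (p : FS A) → ev p (λ _ → 0ℚ) ≡ 0ℚ
  ev-0 p = trans (ev-* p 0ℚ (λ _ → 0ℚ)) (ℚP.*-zeroˡ (ev p (λ _ → 0ℚ)))

  ev-sing : (v : A) (g : A → ℚ) → ev (sing v) g ≡ g v
  ev-sing v g = unit (g v)
    where unit : ∀ x → 1ℚ * x + 0ℚ ≡ x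
          unit = solve-∀ ℚ-ring

module _ {A B : Set} where

  ev-mapFS : (h : A → B) (p : FS A) (g : B → ℚ) → ev (mapFS h p) g ≡ ev p (λ u → g (h u))
  ev-mapFS h [] g = refl
  ev-mapFS h ((c , v) ∷ p) g = cong (c * g (h v) +_) (ev-mapFS h p g)

  ev-lin : (f : A → FS B) (p : FS A) (g : B → ℚ) → ev (lin f p) g ≡ ev p (λ u → ev (f u) g)
  ev-lin f [] g = refl
  ev-lin f ((c , v) ∷ p) g = begin
    ev (scale c (f v) ++ lin f p) g      ≡⟨ ev-++ (scale c (f v)) (lin f p) g ⟩
    ev (scale c (f v)) g + ev (lin f p) g ≡⟨ cong₂ _+_ (ev-scale c (f v) g) (ev-lin f p g) ⟩
    c * ev (f v) g + ev p (λ u → ev (f u) g) ∎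
    where open ≡-Reasoning

  ev-swap : (p : FS A) (q : FS B) (h : A → B → ℚ) →
            ev p (λ u → ev q (h u)) ≡ ev q (λ v → ev p (λ u → h u v))
  ev-swap [] q h = sym (ev-0 q)
  ev-swap ((c , u) ∷ p) q h = begin
    c * ev q (h u) + ev p (λ u′ → ev q (h u′))
      ≡⟨ cong₂ _+_ (sym (ev-* q c (h u))) (ev-swap p q h) ⟩
    ev q (λ v → c * h u v) + ev q (λ v → ev p (λ u′ → h u′ v))
      ≡⟨ sym (ev-+ q _ _) ⟩
    ev q (λ v → c * h u v + ev p (λ u′ → h u′ v)) ∎
    where open ≡-Reasoning

-- Weak equality: two formal sums are identified when all functionals agree on them.
-- It is a record so that both sides remain inferable.
infix 4 _≐_
record _≐_ {A : Set} (p q : FS A) : Set where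
  constructor ≐-intro
  field ≐-ev : (g : A → ℚ) → ev p g ≡ ev q g
open _≐_ public

module _ {A : Set} where

  ≐-refl : {p : FS A} → p ≐ p
  ≐-refl = ≐-intro λ _ → refl

  ≐-sym : {p q : FS A} → p ≐ q → q ≐ p
  ≐-sym e = ≐-intro λ g → sym (≐-ev e g)

  ≐-trans : {p q r : FS A} → p ≐ q → q ≐ r → p ≐ r
  ≐-trans e e′ = ≐-intro λ g → trans (≐-ev e g) (≐-ev e′ g)

  ≡⇒≐ : {p q : FS A} → p ≡ q → p ≐ q
  ≡⇒≐ refl = ≐-refl

  ++-cong : {p p′ q q′ : FS A} → p ≐ p′ → q ≐ q′ → p ++ q ≐ p′ ++ q′
  ++-cong {p} {p′} {q} {q′} e e′ = ≐-intro λ g → begin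
    ev (p ++ q) g      ≡⟨ ev-++ p q g ⟩
    ev p g + ev q g    ≡⟨ cong₂ _+_ (≐-ev e g) (≐-ev e′ g) ⟩
    ev p′ g + ev q′ g  ≡⟨ sym (ev-++ p′ q′ g) ⟩
    ev (p′ ++ q′) g    ∎
    where open ≡-Reasoning

  ++-congˡ : {p p′ : FS A} → p ≐ p′ → (q : FS A) → p ++ q ≐ p′ ++ q
  ++-congˡ e q = ++-cong e (≐-refl {p = q})

  ++-congʳ : (p : FS A) {q q′ : FS A} → q ≐ q′ → p ++ q ≐ p ++ q′
  ++-congʳ p e = ++-cong (≐-refl {p = p}) e

≐-setoid : Set → Setoid 0ℓ 0ℓ
≐-setoid A = record
  { Carrier = FS A ; _≈_ = _≐_
  ; isEquivalence = record { refl = ≐-refl ; sym = ≐-sym ; trans = ≐-trans } }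

module ≐-Reasoning {A : Set} = SetoidReasoning (≐-setoid A)

module _ {A B : Set} where

  lin-cong-fun : {f f′ : A → FS B} → (∀ u → f u ≐ f′ u) → (p : FS A) → lin f p ≐ lin f′ p
  lin-cong-fun e p = ≐-intro λ g → trans (ev-lin _ p g) (trans (ev-cong p (λ u → ≐-ev (e u) g)) (sym (ev-lin _ p g)))

  lin-sing : (f : A → FS B) (v : A) → lin f (sing v) ≐ f v
  lin-sing f v = ≐-intro λ g → trans (ev-lin f (sing v) g) (ev-sing v (λ u → ev (f u) g))

  lin-++-fun : (f f′ : A → FS B) (p : FS A) → lin (λ u → f u ++ f′ u) p ≐ lin f p ++ lin f′ p
  lin-++-fun f f′ p = ≐-intro λ g → begin
    ev (lin (λ u → f u ++ f′ u) p) g          ≡⟨ ev-lin _ p g ⟩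
    ev p (λ u → ev (f u ++ f′ u) g)          ≡⟨ ev-cong p (λ u → ev-++ (f u) (f′ u) g) ⟩
    ev p (λ u → ev (f u) g + ev (f′ u) g)    ≡⟨ ev-+ p _ _ ⟩
    ev p (λ u → ev (f u) g) + ev p (λ u → ev (f′ u) g)
      ≡⟨ cong₂ _+_ (sym (ev-lin f p g)) (sym (ev-lin f′ p g)) ⟩
    ev (lin f p) g + ev (lin f′ p) g         ≡⟨ sym (ev-++ (lin f p) (lin f′ p) g) ⟩
    ev (lin f p ++ lin f′ p) g               ∎
    where open ≡-Reasoning

-- A map of formal sums is linear when it has an adjoint on functionals.  Every
-- construction below (lin, mapFS, bilin in either argument, sums, composites) is.
record Linear {A B : Set} (F : FS A → FS B) : Set where
  field
    dual : (B → ℚ) → A → ℚ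
    ev-dual : (P : FS A) (g : B → ℚ) → ev (F P) g ≡ ev P (dual g)
open Linear public

module _ {A B : Set} {F : FS A → FS B} (L : Linear F) where

  linear-cong : {P Q : FS A} → P ≐ Q → F P ≐ F Q
  linear-cong {P} {Q} e = ≐-intro λ g →
    trans (ev-dual L P g) (trans (≐-ev e (dual L g)) (sym (ev-dual L Q g)))

  linear-lin : {C : Set} (f : C → FS A) (p : FS C) → F (lin f p) ≐ lin (λ u → F (f u)) p
  linear-lin f p = ≐-intro λ g → begin
    ev (F (lin f p)) g                     ≡⟨ ev-dual L (lin f p) g ⟩
    ev (lin f p) (dual L g)                ≡⟨ ev-lin f p (dual L g) ⟩
    ev p (λ u → ev (f u) (dual L g))       ≡⟨ ev-cong p (λ u → sym (ev-dual L (f u) g)) ⟩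
    ev p (λ u → ev (F (f u)) g)            ≡⟨ sym (ev-lin (λ u → F (f u)) p g) ⟩
    ev (lin (λ u → F (f u)) p) g           ∎
    where open ≡-Reasoning

  linear-++ : (P Q : FS A) → F (P ++ Q) ≐ F P ++ F Q
  linear-++ P Q = ≐-intro λ g → begin
    ev (F (P ++ Q)) g                       ≡⟨ ev-dual L (P ++ Q) g ⟩
    ev (P ++ Q) (dual L g)                  ≡⟨ ev-++ P Q (dual L g) ⟩
    ev P (dual L g) + ev Q (dual L g)       ≡⟨ cong₂ _+_ (sym (ev-dual L P g)) (sym (ev-dual L Q g)) ⟩
    ev (F P) g + ev (F Q) g                 ≡⟨ sym (ev-++ (F P) (F Q) g) ⟩
    ev (F P ++ F Q) g                       ∎
    where open ≡-Reasoning

  linear-neg : (P : FS A) → F (neg P) ≐ neg (F P)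
  linear-neg P = ≐-intro λ g → begin
    ev (F (neg P)) g         ≡⟨ ev-dual L (neg P) g ⟩
    ev (neg P) (dual L g)    ≡⟨ ev-neg P (dual L g) ⟩
    - ev P (dual L g)        ≡⟨ cong -_ (sym (ev-dual L P g)) ⟩
    - ev (F P) g             ≡⟨ sym (ev-neg (F P) g) ⟩
    ev (neg (F P)) g         ∎
    where open ≡-Reasoning

  linear-minus : (P R : FS A) → F (P ++ neg R) ≐ F P ++ neg (F R)
  linear-minus P R = ≐-trans (linear-++ P (neg R)) (++-congʳ (F P) (linear-neg R))

  linear-++-neg : (P Q R : FS A) → F (P ++ (Q ++ neg R)) ≐ F P ++ (F Q ++ neg (F R))
  linear-++-neg P Q R = ≐-trans (linear-++ P (Q ++ neg R)) (++-congʳ (F P) (linear-minus Q R))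

  linear-[] : F [] ≐ []
  linear-[] = ≐-intro λ g → ev-dual L [] g

  linear-basis : (P : FS A) → F P ≐ lin (λ u → F (sing u)) P
  linear-basis P = ≐-intro λ g → begin
    ev (F P) g                              ≡⟨ ev-dual L P g ⟩
    ev P (dual L g)                         ≡⟨ ev-cong P (λ u → sym (trans (ev-dual L (sing u) g) (ev-sing u (dual L g)))) ⟩
    ev P (λ u → ev (F (sing u)) g)          ≡⟨ sym (ev-lin (λ u → F (sing u)) P g) ⟩
    ev (lin (λ u → F (sing u)) P) g         ∎
    where open ≡-Reasoning

module _ {A B : Set} where

  lin-linear : (f : A → FS B) → Linear (lin f)
  lin-linear f = record { dual = λ g u → ev (f u) g ; ev-dual = ev-lin f }

  mapFS-linear : (h : A → B) → Linear (mapFS h)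
  mapFS-linear h = record { dual = λ g u → g (h u) ; ev-dual = ev-mapFS h }

  linear-ext : {F G : FS A → FS B} → Linear F → Linear G →
               (∀ u → F (sing u) ≐ G (sing u)) → ∀ P → F P ≐ G P
  linear-ext {F} {G} LF LG e P = begin
    F P                           ≈⟨ linear-basis LF P ⟩
    lin (λ u → F (sing u)) P      ≈⟨ lin-cong-fun e P ⟩
    lin (λ u → G (sing u)) P      ≈⟨ linear-basis LG P ⟨
    G P                           ∎
    where open ≐-Reasoning

neg-linear : {A : Set} → Linear (neg {A})
neg-linear = record { dual = λ g u → - 1ℚ * g u ; ev-dual = λ P g → trans (ev-scale (- 1ℚ) P g) (sym (ev-* P (- 1ℚ) g)) }

module _ {A B C : Set} {F : FS B → FS C} {G : FS A → FS B} where

  ∘-linear : Linear F → Linear G → Linear (λ P → F (G P))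
  ∘-linear LF LG = record
    { dual = λ g → dual LG (dual LF g)
    ; ev-dual = λ P g → trans (ev-dual LF (G P) g) (ev-dual LG P (dual LF g)) }

module _ {A B : Set} {F G : FS A → FS B} where

  ⊕-linear : Linear F → Linear G → Linear (λ P → F P ++ G P)
  ⊕-linear LF LG = record
    { dual = λ g u → dual LF g u + dual LG g u
    ; ev-dual = λ P g → trans (ev-++ (F P) (G P) g)
        (trans (cong₂ _+_ (ev-dual LF P g) (ev-dual LG P g)) (sym (ev-+ P (dual LF g) (dual LG g)))) }

mapFS-∘ : {A B C : Set} (f : B → C) (h : A → B) (p : FS A) → mapFS f (mapFS h p) ≐ mapFS (λ u → f (h u)) p
mapFS-∘ f h p = ≐-intro λ g → trans (ev-mapFS f (mapFS h p) g) (trans (ev-mapFS h p _) (sym (ev-mapFS _ p g)))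

mapFS-id : {A : Set} (p : FS A) → mapFS (λ u → u) p ≐ p
mapFS-id p = ≐-intro λ g → ev-mapFS (λ u → u) p g

lin-sing-map : {A B : Set} (h : A → B) (p : FS A) → lin (λ u → sing (h u)) p ≐ mapFS h p
lin-sing-map h p = ≐-intro λ g → trans (ev-lin _ p g) (trans (ev-cong p (λ u → ev-sing (h u) g)) (sym (ev-mapFS h p g)))

linear-bilin : {A B C D : Set} {H : FS C → FS D} → Linear H → (f : A → B → FS C) (p : FS A) (q : FS B) →
               H (bilin f p q) ≐ bilin (λ u v → H (f u v)) p q
linear-bilin LH f p q = ≐-trans (linear-lin LH (λ u → lin (f u) q) p) (lin-cong-fun (λ u → linear-lin LH (f u) q) p)

lin-sing-id : {A : Set} (p : FS A) → lin sing p ≐ p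
lin-sing-id p = ≐-intro λ g → trans (ev-lin sing p g) (ev-cong p (λ u → ev-sing u g))

lin-mapFS : {A B C : Set} (f : B → FS C) (h : A → B) (p : FS A) → lin f (mapFS h p) ≐ lin (λ u → f (h u)) p
lin-mapFS f h p = ≐-intro λ g → trans (ev-lin f (mapFS h p) g) (trans (ev-mapFS h p _) (sym (ev-lin _ p g)))

lin-mapFS-hom : {A B : Set} (f g : A → FS B) (h : A → A) {F : FS B → FS B} → Linear F →
                (∀ u → f (h u) ≐ F (g u)) → (P : FS A) → lin f (mapFS h P) ≐ F (lin g P)
lin-mapFS-hom f g h LF e P = ≐-trans (lin-mapFS f h P) (≐-trans (lin-cong-fun e P) (≐-sym (linear-lin LF g P)))

module _ {A B C : Set} (f : A → B → FS C) where

  bilinˡ-linear : (Q : FS B) → Linear (λ P → bilin f P Q)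
  bilinˡ-linear Q = lin-linear (λ u → lin (f u) Q)

  bilinʳ-linear : (P : FS A) → Linear (λ Q → bilin f P Q)
  bilinʳ-linear P = record
    { dual = λ g v → ev P (λ u → ev (f u v) g)
    ; ev-dual = λ Q g → begin
        ev (bilin f P Q) g                          ≡⟨ ev-lin _ P g ⟩
        ev P (λ u → ev (lin (f u) Q) g)             ≡⟨ ev-cong P (λ u → ev-lin (f u) Q g) ⟩
        ev P (λ u → ev Q (λ v → ev (f u v) g))      ≡⟨ ev-swap P Q _ ⟩
        ev Q (λ v → ev P (λ u → ev (f u v) g))      ∎ }
    where open ≡-Reasoning

  bilin-sing : (u : A) (v : B) → bilin f (sing u) (sing v) ≐ f u v
  bilin-sing u v = ≐-trans (lin-sing (λ u′ → lin (f u′) (sing v)) u) (lin-sing (f u) v)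

  bilin-cong : {P P′ : FS A} {Q Q′ : FS B} → P ≐ P′ → Q ≐ Q′ → bilin f P Q ≐ bilin f P′ Q′
  bilin-cong {P′ = P′} {Q = Q} e e′ = ≐-trans (linear-cong (bilinˡ-linear Q) e) (linear-cong (bilinʳ-linear P′) e′)

bilin-lin : {A A′ B B′ C : Set} (f : A → B → FS C) (g : A′ → FS A) (h : B′ → FS B) (p : FS A′) (q : FS B′) →
            bilin f (lin g p) (lin h q) ≐ bilin (λ u v → bilin f (g u) (h v)) p q
bilin-lin f g h p q = begin
  bilin f (lin g p) (lin h q)                                 ≈⟨ linear-lin (bilinˡ-linear f (lin h q)) g p ⟩
  lin (λ u → bilin f (g u) (lin h q)) p                       ≈⟨ lin-cong-fun (λ u → linear-lin (bilinʳ-linear f (g u)) h q) p ⟩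
  bilin (λ u v → bilin f (g u) (h v)) p q                     ∎
  where open ≐-Reasoning

lin-swap : {A B C : Set} (h : A → B → FS C) (p : FS A) (q : FS B) →
           lin (λ u → lin (h u) q) p ≐ lin (λ v → lin (λ u → h u v) p) q
lin-swap h p q = ≐-intro λ g → begin
  ev (lin (λ u → lin (h u) q) p) g                 ≡⟨ ev-lin _ p g ⟩
  ev p (λ u → ev (lin (h u) q) g)                  ≡⟨ ev-cong p (λ u → ev-lin (h u) q g) ⟩
  ev p (λ u → ev q (λ v → ev (h u v) g))           ≡⟨ ev-swap p q _ ⟩
  ev q (λ v → ev p (λ u → ev (h u v) g))           ≡⟨ ev-cong q (λ v → sym (ev-lin (λ u → h u v) p g)) ⟩
  ev q (λ v → ev (lin (λ u → h u v) p) g)          ≡⟨ sym (ev-lin _ q g) ⟩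
  ev (lin (λ v → lin (λ u → h u v) p) q) g         ∎
  where open ≡-Reasoning

ev-bilin : {A B C : Set} (f : A → B → FS C) (p : FS A) (q : FS B) (g : C → ℚ) →
           ev (bilin f p q) g ≡ ev p (λ u → ev q (λ v → ev (f u v) g))
ev-bilin f p q g = trans (ev-lin _ p g) (ev-cong p (λ u → ev-lin (f u) q g))

record Bilinear {A B C : Set} (β : FS A → FS B → FS C) : Set where
  field
    linearˡ : (Q : FS B) → Linear (λ P → β P Q)
    linearʳ : (P : FS A) → Linear (λ Q → β P Q)
open Bilinear public

module _ {A B C : Set} where

  bilin-bilinear : (f : A → B → FS C) → Bilinear (bilin f)
  bilin-bilinear f = record { linearˡ = bilinˡ-linear f ; linearʳ = bilinʳ-linear f }

  bilinear-ext : {β β′ : FS A → FS B → FS C} → Bilinear β → Bilinear β′ →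
                 (∀ u v → β (sing u) (sing v) ≐ β′ (sing u) (sing v)) → ∀ P Q → β P Q ≐ β′ P Q
  bilinear-ext Lβ Lβ′ e P Q =
    linear-ext (linearˡ Lβ Q) (linearˡ Lβ′ Q)
      (λ u → linear-ext (linearʳ Lβ (sing u)) (linearʳ Lβ′ (sing u)) (e u) Q) P

  ⊕-bilinear : {β β′ : FS A → FS B → FS C} → Bilinear β → Bilinear β′ →
               Bilinear (λ P Q → β P Q ++ β′ P Q)
  ⊕-bilinear Lβ Lβ′ = record
    { linearˡ = λ Q → ⊕-linear (linearˡ Lβ Q) (linearˡ Lβ′ Q)
    ; linearʳ = λ P → ⊕-linear (linearʳ Lβ P) (linearʳ Lβ′ P) }

module _ {A B C D : Set} {β : FS A → FS B → FS C} where

  ∘-bilinear : {H : FS C → FS D} → Linear H → Bilinear β → Bilinear (λ P Q → H (β P Q))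
  ∘-bilinear LH Lβ = record
    { linearˡ = λ Q → ∘-linear LH (linearˡ Lβ Q)
    ; linearʳ = λ P → ∘-linear LH (linearʳ Lβ P) }

module _ {A A′ B B′ C : Set} {β : FS A → FS B → FS C} where

  bilinear-∘ : {F : FS A′ → FS A} {G : FS B′ → FS B} → Bilinear β → Linear F → Linear G →
               Bilinear (λ P Q → β (F P) (G Q))
  bilinear-∘ {F} {G} Lβ LF LG = record
    { linearˡ = λ Q → ∘-linear (linearˡ Lβ (G Q)) LF
    ; linearʳ = λ P → ∘-linear (linearʳ Lβ (F P)) LG }

zero-linear : {A B : Set} → Linear {A} {B} (λ _ → [])
zero-linear = record { dual = λ g _ → 0ℚ ; ev-dual = λ P g → sym (ev-0 P) }

zero-bilinear : {A B C : Set} → Bilinear {A} {B} {C} (λ _ _ → [])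
zero-bilinear = record { linearˡ = λ _ → zero-linear ; linearʳ = λ _ → zero-linear }

id-linear : {A : Set} → Linear {A} (λ P → P)
id-linear = record { dual = λ g → g ; ev-dual = λ P g → refl }

family-linear : {A B I : Set} {F : I → FS A → FS B} → (∀ i → Linear (F i)) →
                (ℓ : FS I) → Linear (λ P → lin (λ i → F i P) ℓ)
family-linear {F = F} LF ℓ = record
  { dual = λ g u → ev ℓ (λ i → dual (LF i) g u)
  ; ev-dual = λ P g → begin
      ev (lin (λ i → F i P) ℓ) g                ≡⟨ ev-lin _ ℓ g ⟩
      ev ℓ (λ i → ev (F i P) g)                 ≡⟨ ev-cong ℓ (λ i → ev-dual (LF i) P g) ⟩
      ev ℓ (λ i → ev P (dual (LF i) g))         ≡⟨ ev-swap ℓ P _ ⟩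
      ev P (λ u → ev ℓ (λ i → dual (LF i) g u)) ∎ }
  where open ≡-Reasoning

bilin-zero : {A B C : Set} (p : FS A) (q : FS B) → bilin {C = C} (λ _ _ → []) p q ≐ []
bilin-zero p q = ≐-intro λ g → trans (ev-bilin (λ _ _ → []) p q g) (trans (ev-cong p (λ _ → ev-0 q)) (ev-0 p))

bilin-++-fun : {A B C : Set} (F G : A → B → FS C) (p : FS A) (q : FS B) →
               bilin (λ u v → F u v ++ G u v) p q ≐ bilin F p q ++ bilin G p q
bilin-++-fun F G p q =
  ≐-trans (lin-cong-fun (λ u → lin-++-fun (F u) (G u) q) p) (lin-++-fun _ _ p)

module _ {A I J : Set} (f : A → A → FS A)
         (φ : I → FS A → FS A) (φ-linear : ∀ i → Linear (φ i))
         (ψ : J → FS A → FS A) (ψ-linear : ∀ j → Linear (ψ j)) where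

  leibniz-extend :
    (X Y : FS A) (R : I → J → FS A) →
    (∀ i j → bilin f (φ i X) (ψ j Y) ≐ φ i (bilin f X (ψ j Y)) ++ (ψ j (bilin f (φ i X) Y) ++ R i j)) →
    (ℓ : FS I) (m : FS J) →
    bilin f (lin (λ i → φ i X) ℓ) (lin (λ j → ψ j Y) m) ≐
      lin (λ i → φ i (bilin f X (lin (λ j → ψ j Y) m))) ℓ ++
      (lin (λ j → ψ j (bilin f (lin (λ i → φ i X) ℓ) Y)) m ++ bilin R ℓ m)
  leibniz-extend X Y R rule ℓ m = begin
    bilin f ℓX mY
      ≈⟨ bilin-lin f (λ i → φ i X) (λ j → ψ j Y) ℓ m ⟩
    bilin (λ i j → bilin f (φ i X) (ψ j Y)) ℓ m
      ≈⟨ lin-cong-fun (λ i → lin-cong-fun (rule i) m) ℓ ⟩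
    bilin (λ i j → φ i (bilin f X (ψ j Y)) ++ (ψ j (bilin f (φ i X) Y) ++ R i j)) ℓ m
      ≈⟨ ≐-trans (bilin-++-fun _ _ ℓ m) (++-cong ≐-refl (bilin-++-fun _ R ℓ m)) ⟩
    bilin (λ i j → φ i (bilin f X (ψ j Y))) ℓ m ++
      (bilin (λ i j → ψ j (bilin f (φ i X) Y)) ℓ m ++ bilin R ℓ m)
      ≈⟨ ++-cong left (++-cong right ≐-refl) ⟩
    lin (λ i → φ i (bilin f X mY)) ℓ ++ (lin (λ j → ψ j (bilin f ℓX Y)) m ++ bilin R ℓ m) ∎
    where
    open ≐-Reasoning
    ℓX = lin (λ i → φ i X) ℓ
    mY = lin (λ j → ψ j Y) m
    left : bilin (λ i j → φ i (bilin f X (ψ j Y))) ℓ m ≐ lin (λ i → φ i (bilin f X mY)) ℓ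
    left = lin-cong-fun (λ i → ≐-sym (≐-trans
             (linear-cong (φ-linear i) (linear-lin (bilinʳ-linear f X) (λ j → ψ j Y) m))
             (linear-lin (φ-linear i) (λ j → bilin f X (ψ j Y)) m))) ℓ
    right : bilin (λ i j → ψ j (bilin f (φ i X) Y)) ℓ m ≐ lin (λ j → ψ j (bilin f ℓX Y)) m
    right = ≐-trans (lin-swap (λ i j → ψ j (bilin f (φ i X) Y)) ℓ m)
              (lin-cong-fun (λ j → ≐-sym (≐-trans
                 (linear-cong (ψ-linear j) (linear-lin (bilinˡ-linear f Y) (λ i → φ i X) ℓ))
                 (linear-lin (ψ-linear j) (λ i → bilin f (φ i X) Y) ℓ))) m)

-- Linear combinations of n formal sums, and the check of identities between them by
-- the ring solver on the values of the summands under a functional.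
data LinExpr (n : ℕ) : Set where
  var : Fin n → LinExpr n
  _⊹_ : LinExpr n → LinExpr n → LinExpr n
  ⊟_  : LinExpr n → LinExpr n
  ∅   : LinExpr n

infixl 6 _⊹_
infix 8 ⊟_

v : {n : ℕ} (i : ℕ) {i<n : True (i ℕ.<? n)} → LinExpr n
v i {i<n} = var (#_ i {m<n = i<n})

⟦_⟧ : {A : Set} {n : ℕ} → LinExpr n → Vec (FS A) n → FS A
⟦ var i ⟧ ρ = lookup ρ i
⟦ t ⊹ s ⟧ ρ = ⟦ t ⟧ ρ ++ ⟦ s ⟧ ρ
⟦ ⊟ t ⟧ ρ = neg (⟦ t ⟧ ρ)
⟦ ∅ ⟧ ρ = []

toPoly : {n : ℕ} → LinExpr n → Polynomial n
toPoly (var i) = ⟨ i ⟩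
toPoly (t ⊹ s) = toPoly t :+ toPoly s
toPoly (⊟ t) = :- toPoly t
toPoly ∅ = con 0ℚ

ev-⟦⟧ : {A : Set} {n : ℕ} (t : LinExpr n) (ρ : Vec (FS A) n) (g : A → ℚ) →
        ev (⟦ t ⟧ ρ) g ≡ ⟦ toPoly t ⟧ℚ (Vec.map (λ P → ev P g) ρ)
ev-⟦⟧ (var i) ρ g = sym (lookup-map i _ ρ)
ev-⟦⟧ (t ⊹ s) ρ g = trans (ev-++ (⟦ t ⟧ ρ) (⟦ s ⟧ ρ) g) (cong₂ _+_ (ev-⟦⟧ t ρ g) (ev-⟦⟧ s ρ g))
ev-⟦⟧ (⊟ t) ρ g = trans (ev-neg (⟦ t ⟧ ρ) g) (cong -_ (ev-⟦⟧ t ρ g))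
ev-⟦⟧ ∅ ρ g = refl

lin-comb : {A : Set} {n : ℕ} (t s : LinExpr n) →
           (∀ env → ⟦ toPoly t ⟧↓ env ≡ ⟦ toPoly s ⟧↓ env) →
           (ρ : Vec (FS A) n) → ⟦ t ⟧ ρ ≐ ⟦ s ⟧ ρ
lin-comb t s same ρ = ≐-intro λ g → let env = Vec.map (λ P → ev P g) ρ in begin
  ev (⟦ t ⟧ ρ) g           ≡⟨ ev-⟦⟧ t ρ g ⟩
  ⟦ toPoly t ⟧ℚ env        ≡⟨ sym (correct (toPoly t) env) ⟩
  ⟦ toPoly t ⟧↓ env        ≡⟨ same env ⟩
  ⟦ toPoly s ⟧↓ env        ≡⟨ correct (toPoly s) env ⟩
  ⟦ toPoly s ⟧ℚ env        ≡⟨ sym (ev-⟦⟧ s ρ g) ⟩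
  ev (⟦ s ⟧ ρ) g           ∎
  where open ≡-Reasoning

-- Coefficients: δ w is the coefficient functional of the word w, so _≐_ implies _≈_.
δ : Word → Word → ℚ
δ w u with u ≟W w
... | yes _ = 1ℚ
... | no _ = 0ℚ

coeff-ev : (p : Poly) (w : Word) → coeff p w ≡ ev p (δ w)
coeff-ev [] w = refl
coeff-ev ((c , u) ∷ p) w with u ≟W w
... | yes _ = cong₂ _+_ (sym (ℚP.*-identityʳ c)) (coeff-ev p w)
... | no _ = trans (coeff-ev p w) (sym (trans (cong (_+ ev p (δ w)) (ℚP.*-zeroʳ c)) (ℚP.+-identityˡ _)))

≐⇒≈ : {p q : Poly} → p ≐ q → p ≈ q
≐⇒≈ {p} {q} e w = trans (coeff-ev p w) (trans (≐-ev e (δ w)) (sym (coeff-ev q w)))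

≈-setoid : Setoid 0ℓ 0ℓ
≈-setoid = record
  { Carrier = Poly ; _≈_ = _≈_
  ; isEquivalence = record { refl = λ _ → refl ; sym = λ e w → sym (e w) ; trans = λ e e′ w → trans (e w) (e′ w) } }

module ≈-Reasoning = SetoidReasoning ≈-setoid

remove : Word → Poly → Poly
remove v [] = []
remove v ((c , u) ∷ p) with u ≟W v
... | yes _ = remove v p
... | no _ = (c , u) ∷ remove v p

ev-remove : (v : Word) (p : Poly) (h : Word → ℚ) → ev p h ≡ coeff p v * h v + ev (remove v p) h
ev-remove v [] h = sym (trans (cong (_+ 0ℚ) (ℚP.*-zeroˡ (h v))) (ℚP.+-identityˡ 0ℚ))
ev-remove v ((c , u) ∷ p) h with u ≟W v
... | yes refl = trans (cong (c * h u +_) (ev-remove u p h)) (regroup c (h u) (coeff p u) (ev (remove u p) h))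
  where regroup : ∀ c x k e → c * x + (k * x + e) ≡ (c + k) * x + e
        regroup = solve-∀ ℚ-ring
... | no _ = trans (cong (c * h u +_) (ev-remove v p h)) (regroup (c * h u) (coeff p v * h v) (ev (remove v p) h))
  where regroup : ∀ x y e → x + (y + e) ≡ y + (x + e)
        regroup = solve-∀ ℚ-ring

coeff-remove-≢ : (v w : Word) → v ≢ w → (p : Poly) → coeff (remove v p) w ≡ coeff p w
coeff-remove-≢ v w v≢w [] = refl
coeff-remove-≢ v w v≢w ((c , u) ∷ p) with u ≟W v
coeff-remove-≢ v w v≢w ((c , u) ∷ p) | yes refl with u ≟W w
... | yes refl = ⊥-elim (v≢w refl)
... | no _ = coeff-remove-≢ v w v≢w p
coeff-remove-≢ v w v≢w ((c , u) ∷ p) | no _ with u ≟W w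
... | yes _ = cong (c +_) (coeff-remove-≢ v w v≢w p)
... | no _ = coeff-remove-≢ v w v≢w p

coeff-remove-≡ : (v : Word) (p : Poly) → coeff (remove v p) v ≡ 0ℚ
coeff-remove-≡ v [] = refl
coeff-remove-≡ v ((c , u) ∷ p) with u ≟W v
... | yes _ = coeff-remove-≡ v p
... | no u≢v with u ≟W v
...   | yes u≡v = ⊥-elim (u≢v u≡v)
...   | no _ = coeff-remove-≡ v p

length-remove : (v : Word) (p : Poly) → length (remove v p) ℕ.≤ length p
length-remove v [] = ℕ.z≤n
length-remove v ((c , u) ∷ p) with u ≟W v
... | yes _ = ℕP.m≤n⇒m≤1+n (length-remove v p)
... | no _ = ℕ.s≤s (length-remove v p)

-- ev p h depends only on the values of h at the words with nonzero coefficient in p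
-- (induction on the length of p, removing one word with all its occurrences at a time).
ev-support : (p : Poly) {h h′ : Word → ℚ} →
             (∀ u → coeff p u ≢ 0ℚ → h u ≡ h′ u) → ev p h ≡ ev p h′
ev-support p = bounded (length p) p ℕP.≤-refl
  where
  bounded : (n : ℕ) (p : Poly) → length p ℕ.≤ n → {h h′ : Word → ℚ} →
            (∀ u → coeff p u ≢ 0ℚ → h u ≡ h′ u) → ev p h ≡ ev p h′
  bounded n [] _ _ = refl
  bounded (suc n) p@((c , v) ∷ p′) (ℕ.s≤s len) {h} {h′} agree = begin
    ev p h                                    ≡⟨ ev-remove v p h ⟩
    coeff p v * h v + ev (remove v p) h       ≡⟨ cong₂ _+_ head (bounded n (remove v p) shorter agree′) ⟩
    coeff p v * h′ v + ev (remove v p) h′     ≡⟨ sym (ev-remove v p h′) ⟩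
    ev p h′                                   ∎
    where
    open ≡-Reasoning
    head : coeff p v * h v ≡ coeff p v * h′ v
    head with coeff p v ≟ 0ℚ
    ... | yes z = trans (cong (_* h v) z) (trans (ℚP.*-zeroˡ (h v)) (sym (trans (cong (_* h′ v) z) (ℚP.*-zeroˡ (h′ v)))))
    ... | no nz = cong (coeff p v *_) (agree v nz)
    shorter : length (remove v p) ℕ.≤ n
    shorter with v ≟W v
    ... | yes _ = ℕP.≤-trans (length-remove v p′) len
    ... | no v≢v = ⊥-elim (v≢v refl)
    agree′ : ∀ u → coeff (remove v p) u ≢ 0ℚ → h u ≡ h′ u
    agree′ u nz = agree u λ z → nz (lemma z)
      where
      lemma : coeff p u ≡ 0ℚ → coeff (remove v p) u ≡ 0ℚ
      lemma z = by-cases (v ≟W u)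
        where
        by-cases : Dec (v ≡ u) → coeff (remove v p) u ≡ 0ℚ
        by-cases (yes refl) = coeff-remove-≡ v p
        by-cases (no v≢u) = trans (coeff-remove-≢ v u v≢u p) z

ev-on-H1 : (p : Poly) → InH1 p → {h h′ : Word → ℚ} →
           (∀ u → H1Word u → h u ≡ h′ u) → ev p h ≡ ev p h′
ev-on-H1 p hp agree = ev-support p (λ u nz → agree u (hp u nz))

lin-on-H1 : (p : Poly) → InH1 p → {f g : Word → Poly} →
            (∀ u → H1Word u → f u ≐ g u) → lin f p ≈ lin g p
lin-on-H1 p hp {f} {g} agree w = begin
  coeff (lin f p) w                   ≡⟨ coeff-ev (lin f p) w ⟩
  ev (lin f p) (δ w)                  ≡⟨ ev-lin f p (δ w) ⟩
  ev p (λ u → ev (f u) (δ w))         ≡⟨ ev-on-H1 p hp (λ u hu → ≐-ev (agree u hu) (δ w)) ⟩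
  ev p (λ u → ev (g u) (δ w))         ≡⟨ sym (ev-lin g p (δ w)) ⟩
  ev (lin g p) (δ w)                  ≡⟨ sym (coeff-ev (lin g p) w) ⟩
  coeff (lin g p) w                   ∎
  where open ≡-Reasoning

bilin-on-H1 : (p q : Poly) → InH1 p → InH1 q → {F G : Word → Word → Poly} →
              (∀ u v → H1Word u → H1Word v → F u v ≐ G u v) → bilin F p q ≈ bilin G p q
bilin-on-H1 p q hp hq {F} {G} agree = lin-on-H1 p hp λ u hu → ≐-intro λ g → begin
  ev (lin (F u) q) g                  ≡⟨ ev-lin (F u) q g ⟩
  ev q (λ v → ev (F u v) g)           ≡⟨ ev-on-H1 q hq (λ v hv → ≐-ev (agree u v hu hv) g) ⟩
  ev q (λ v → ev (G u v) g)           ≡⟨ sym (ev-lin (G u) q g) ⟩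
  ev (lin (G u) q) g                  ∎
  where open ≡-Reasoning

H1-tail : (a : Letter) (u : Word) → H1Word (a ∷ u) → H1Word u
H1-tail a u (inj₁ ())
H1-tail a .[] (inj₂ ([] , refl)) = inj₁ refl
H1-tail a .(F ++ 𝕪 ∷ []) (inj₂ (b ∷ F , refl)) = inj₂ (F , refl)

H1-letter : (a : Letter) → H1Word (a ∷ []) → a ≡ 𝕪
H1-letter a (inj₁ ())
H1-letter a (inj₂ ([] , refl)) = refl
H1-letter a (inj₂ (b ∷ [] , ()))
H1-letter a (inj₂ (b ∷ c ∷ F , ()))

dropLastY-snoc : (F : Word) → dropLastY (F ++ 𝕪 ∷ []) ≡ just F
dropLastY-snoc [] = refl
dropLastY-snoc (𝕩 ∷ []) = refl
dropLastY-snoc (𝕪 ∷ []) = refl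
dropLastY-snoc (𝕩 ∷ b ∷ F) rewrite dropLastY-snoc (b ∷ F) = refl
dropLastY-snoc (𝕪 ∷ b ∷ F) rewrite dropLastY-snoc (b ∷ F) = refl

Sw-snoc : (F : Word) → Sw (F ++ 𝕪 ∷ []) ≡ rmulY (S₁w F)
Sw-snoc [] = refl
Sw-snoc (a ∷ F) rewrite dropLastY-snoc (a ∷ F) = refl

S̃w-snoc : (F : Word) → S̃w (F ++ 𝕪 ∷ []) ≡ rmulY (S₂w F)
S̃w-snoc [] = refl
S̃w-snoc (a ∷ F) rewrite dropLastY-snoc (a ∷ F) = refl

lmul-linear : (a : Letter) → Linear (lmul a)
lmul-linear a = mapFS-linear (a ∷_)

rmulY-linear : Linear rmulY
rmulY-linear = mapFS-linear (_++ 𝕪 ∷ [])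

-- Left multiplication by S₁(a) and by S₂(a), i.e. S₁(x) = x, S₁(y) = x + y,
-- S₂(x) = x, S₂(y) = y − x.
σ₁ σ₂ : Letter → Poly → Poly
σ₁ 𝕩 P = lmul 𝕩 P
σ₁ 𝕪 P = lmul 𝕩 P ++ lmul 𝕪 P
σ₂ 𝕩 P = lmul 𝕩 P
σ₂ 𝕪 P = lmul 𝕪 P ++ neg (lmul 𝕩 P)

σ₁-linear : (a : Letter) → Linear (σ₁ a)
σ₁-linear 𝕩 = lmul-linear 𝕩
σ₁-linear 𝕪 = ⊕-linear (lmul-linear 𝕩) (lmul-linear 𝕪)

σ₂-linear : (a : Letter) → Linear (σ₂ a)
σ₂-linear 𝕩 = lmul-linear 𝕩
σ₂-linear 𝕪 = ⊕-linear (lmul-linear 𝕪) (∘-linear neg-linear (lmul-linear 𝕩))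

S₁ S₂ : Poly → Poly
S₁ = lin S₁w
S₂ = lin S₂w

S₁w-cons : (a : Letter) (u : Word) → S₁w (a ∷ u) ≡ σ₁ a (S₁w u)
S₁w-cons 𝕩 u = refl
S₁w-cons 𝕪 u = refl

S₂w-cons : (a : Letter) (u : Word) → S₂w (a ∷ u) ≡ σ₂ a (S₂w u)
S₂w-cons 𝕩 u = refl
S₂w-cons 𝕪 u = refl

S₁-lmul : (a : Letter) (P : Poly) → S₁ (lmul a P) ≐ σ₁ a (S₁ P)
S₁-lmul a = lin-mapFS-hom S₁w S₁w (a ∷_) (σ₁-linear a) (λ u → ≡⇒≐ (S₁w-cons a u))

S₂-lmul : (a : Letter) (P : Poly) → S₂ (lmul a P) ≐ σ₂ a (S₂ P)
S₂-lmul a = lin-mapFS-hom S₂w S₂w (a ∷_) (σ₂-linear a) (λ u → ≡⇒≐ (S₂w-cons a u))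

S₂-σ₁ : (a : Letter) (P : Poly) → S₂ (σ₁ a P) ≐ lmul a (S₂ P)
S₂-σ₁ 𝕩 P = S₂-lmul 𝕩 P
S₂-σ₁ 𝕪 P = begin
  S₂ (lmul 𝕩 P ++ lmul 𝕪 P)                            ≈⟨ linear-++ (lin-linear S₂w) (lmul 𝕩 P) (lmul 𝕪 P) ⟩
  S₂ (lmul 𝕩 P) ++ S₂ (lmul 𝕪 P)                       ≈⟨ ++-cong (S₂-lmul 𝕩 P) (S₂-lmul 𝕪 P) ⟩
  lmul 𝕩 (S₂ P) ++ (lmul 𝕪 (S₂ P) ++ neg (lmul 𝕩 (S₂ P)))
    ≈⟨ lin-comb (v 0 ⊹ (v 1 ⊹ ⊟ v 0)) (v 1) (λ _ → refl) (lmul 𝕩 (S₂ P) ∷ lmul 𝕪 (S₂ P) ∷ []) ⟩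
  lmul 𝕪 (S₂ P)                                       ∎
  where open ≐-Reasoning

S₁-σ₂ : (a : Letter) (P : Poly) → S₁ (σ₂ a P) ≐ lmul a (S₁ P)
S₁-σ₂ 𝕩 P = S₁-lmul 𝕩 P
S₁-σ₂ 𝕪 P = begin
  S₁ (lmul 𝕪 P ++ neg (lmul 𝕩 P))                      ≈⟨ linear-++ (lin-linear S₁w) (lmul 𝕪 P) (neg (lmul 𝕩 P)) ⟩
  S₁ (lmul 𝕪 P) ++ S₁ (neg (lmul 𝕩 P))                 ≈⟨ ++-cong (S₁-lmul 𝕪 P) (≐-trans (linear-neg (lin-linear S₁w) (lmul 𝕩 P)) (linear-cong neg-linear (S₁-lmul 𝕩 P))) ⟩
  (lmul 𝕩 (S₁ P) ++ lmul 𝕪 (S₁ P)) ++ neg (lmul 𝕩 (S₁ P))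
    ≈⟨ lin-comb ((v 0 ⊹ v 1) ⊹ ⊟ v 0) (v 1) (λ _ → refl) (lmul 𝕩 (S₁ P) ∷ lmul 𝕪 (S₁ P) ∷ []) ⟩
  lmul 𝕪 (S₁ P)                                       ∎
  where open ≐-Reasoning

S₂∘S₁ : (F : Word) → S₂ (S₁w F) ≐ sing F
S₂∘S₁ [] = lin-sing S₂w []
S₂∘S₁ (a ∷ F) = begin
  S₂ (S₁w (a ∷ F))          ≡⟨ cong S₂ (S₁w-cons a F) ⟩
  S₂ (σ₁ a (S₁w F))         ≈⟨ S₂-σ₁ a (S₁w F) ⟩
  lmul a (S₂ (S₁w F))       ≈⟨ linear-cong (lmul-linear a) (S₂∘S₁ F) ⟩
  sing (a ∷ F)              ∎
  where open ≐-Reasoning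

S₁∘S₂ : (F : Word) → S₁ (S₂w F) ≐ sing F
S₁∘S₂ [] = lin-sing S₁w []
S₁∘S₂ (a ∷ F) = begin
  S₁ (S₂w (a ∷ F))          ≡⟨ cong S₁ (S₂w-cons a F) ⟩
  S₁ (σ₂ a (S₂w F))         ≈⟨ S₁-σ₂ a (S₂w F) ⟩
  lmul a (S₁ (S₂w F))       ≈⟨ linear-cong (lmul-linear a) (S₁∘S₂ F) ⟩
  sing (a ∷ F)              ∎
  where open ≐-Reasoning

S̃-rmulY : (P : Poly) → S̃ (rmulY P) ≐ rmulY (S₂ P)
S̃-rmulY = lin-mapFS-hom S̃w S₂w (_++ 𝕪 ∷ []) rmulY-linear (λ u → ≡⇒≐ (S̃w-snoc u))

S-rmulY : (P : Poly) → S (rmulY P) ≐ rmulY (S₁ P)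
S-rmulY = lin-mapFS-hom Sw S₁w (_++ 𝕪 ∷ []) rmulY-linear (λ u → ≡⇒≐ (Sw-snoc u))

S̃∘S-word : (w : Word) → H1Word w → S̃ (Sw w) ≐ sing w
S̃∘S-word .[] (inj₁ refl) = lin-sing S̃w []
S̃∘S-word .(F ++ 𝕪 ∷ []) (inj₂ (F , refl)) = begin
  S̃ (Sw (F ++ 𝕪 ∷ []))        ≡⟨ cong S̃ (Sw-snoc F) ⟩
  S̃ (rmulY (S₁w F))           ≈⟨ S̃-rmulY (S₁w F) ⟩
  rmulY (S₂ (S₁w F))          ≈⟨ linear-cong rmulY-linear (S₂∘S₁ F) ⟩
  sing (F ++ 𝕪 ∷ [])          ∎
  where open ≐-Reasoning

S∘S̃-word : (w : Word) → H1Word w → S (S̃w w) ≐ sing w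
S∘S̃-word .[] (inj₁ refl) = lin-sing Sw []
S∘S̃-word .(F ++ 𝕪 ∷ []) (inj₂ (F , refl)) = begin
  S (S̃w (F ++ 𝕪 ∷ []))        ≡⟨ cong S (S̃w-snoc F) ⟩
  S (rmulY (S₂w F))           ≈⟨ S-rmulY (S₂w F) ⟩
  rmulY (S₁ (S₂w F))          ≈⟨ linear-cong rmulY-linear (S₁∘S₂ F) ⟩
  sing (F ++ 𝕪 ∷ [])          ∎
  where open ≐-Reasoning

S̃∘S : (p : Poly) → InH1 p → S̃ (S p) ≈ p
S̃∘S p hp = begin
  S̃ (S p)                    ≈⟨ ≐⇒≈ (linear-lin (lin-linear S̃w) Sw p) ⟩
  lin (λ u → S̃ (Sw u)) p     ≈⟨ lin-on-H1 p hp S̃∘S-word ⟩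
  lin sing p                 ≈⟨ ≐⇒≈ (lin-sing-id p) ⟩
  p                          ∎
  where open ≈-Reasoning

S∘S̃ : (p : Poly) → InH1 p → S (S̃ p) ≈ p
S∘S̃ p hp = begin
  S (S̃ p)                    ≈⟨ ≐⇒≈ (linear-lin (lin-linear Sw) S̃w p) ⟩
  lin (λ u → S (S̃w u)) p     ≈⟨ lin-on-H1 p hp S∘S̃-word ⟩
  lin sing p                 ≈⟨ ≐⇒≈ (lin-sing-id p) ⟩
  p                          ∎
  where open ≈-Reasoning

posw : Word → Poly
posw [] = []
posw (a ∷ w) = sing (a ∷ w)

pos : Poly → Poly
pos = lin posw

pos-linear : Linear pos
pos-linear = lin-linear posw

NoConst : Poly → Set
NoConst X = pos X ≐ X

noConst-cong : {X Y : Poly} → X ≐ Y → NoConst X → NoConst Y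
noConst-cong e nc = ≐-trans (linear-cong pos-linear (≐-sym e)) (≐-trans nc e)

noConst-lmul : (a : Letter) (P : Poly) → NoConst (lmul a P)
noConst-lmul a P = ≐-trans (lin-mapFS posw (a ∷_) P) (lin-sing-map (a ∷_) P)

noConst-rmulY : (P : Poly) → NoConst (rmulY P)
noConst-rmulY P = ≐-trans (lin-mapFS posw (_++ 𝕪 ∷ []) P)
  (≐-trans (lin-cong-fun (λ u → ≡⇒≐ (posw-snoc u)) P) (lin-sing-map (_++ 𝕪 ∷ []) P))
  where
  posw-snoc : (u : Word) → posw (u ++ 𝕪 ∷ []) ≡ sing (u ++ 𝕪 ∷ [])
  posw-snoc [] = refl
  posw-snoc (_ ∷ _) = refl

-- S̃ (a w) = θ a (S̃ w).  On polynomials without constant term θ a is left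
-- multiplication by S₂(a) (θ-σ₂), while θ 𝕩 1 = 0 and θ 𝕪 1 = y.
θ : Letter → Poly → Poly
θ 𝕩 X = lmul 𝕩 (pos X)
θ 𝕪 X = lmul 𝕪 X ++ neg (lmul 𝕩 (pos X))

θ-linear : (a : Letter) → Linear (θ a)
θ-linear 𝕩 = ∘-linear (lmul-linear 𝕩) pos-linear
θ-linear 𝕪 = ⊕-linear (lmul-linear 𝕪) (∘-linear neg-linear (∘-linear (lmul-linear 𝕩) pos-linear))

θ-σ₂ : (a : Letter) {X : Poly} → NoConst X → θ a X ≐ σ₂ a X
θ-σ₂ 𝕩 nc = linear-cong (lmul-linear 𝕩) nc
θ-σ₂ 𝕪 {X} nc = ++-congʳ (lmul 𝕪 X) (linear-cong (∘-linear neg-linear (lmul-linear 𝕩)) nc)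

noConst-θ : (a : Letter) (X : Poly) → NoConst (θ a X)
noConst-θ 𝕩 X = noConst-lmul 𝕩 (pos X)
noConst-θ 𝕪 X = ≐-trans (linear-++ pos-linear (lmul 𝕪 X) _)
  (++-cong (noConst-lmul 𝕪 X) (≐-trans (linear-neg pos-linear (lmul 𝕩 (pos X))) (linear-cong neg-linear (noConst-lmul 𝕩 (pos X)))))

rmulY-lmul : (a : Letter) (P : Poly) → rmulY (lmul a P) ≐ lmul a (rmulY P)
rmulY-lmul a P = ≐-trans (mapFS-∘ (_++ 𝕪 ∷ []) (a ∷_) P) (≐-sym (mapFS-∘ (a ∷_) (_++ 𝕪 ∷ []) P))

rmulY-σ₂ : (a : Letter) (P : Poly) → rmulY (σ₂ a P) ≐ σ₂ a (rmulY P)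
rmulY-σ₂ 𝕩 P = rmulY-lmul 𝕩 P
rmulY-σ₂ 𝕪 P = ≐-trans (linear-minus rmulY-linear (lmul 𝕪 P) (lmul 𝕩 P))
  (++-cong (rmulY-lmul 𝕪 P) (linear-cong neg-linear (rmulY-lmul 𝕩 P)))

S̃w-cons : (a : Letter) (W : Word) → S̃w (a ∷ W) ≐ θ a (S̃w W)
S̃w-cons 𝕩 [] = ≐-refl
S̃w-cons 𝕪 [] = ≐-refl
S̃w-cons 𝕩 (c ∷ W) with dropLastY (c ∷ W)
... | just F = ≐-trans (rmulY-σ₂ 𝕩 (S₂w F)) (≐-sym (θ-σ₂ 𝕩 (noConst-rmulY (S₂w F))))
... | nothing = ≐-refl
S̃w-cons 𝕪 (c ∷ W) with dropLastY (c ∷ W)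
... | just F = ≐-trans (rmulY-σ₂ 𝕪 (S₂w F)) (≐-sym (θ-σ₂ 𝕪 (noConst-rmulY (S₂w F))))
... | nothing = ≐-refl

noConst-S̃w : (c : Letter) (u : Word) → NoConst (S̃w (c ∷ u))
noConst-S̃w c u = noConst-cong (≐-sym (S̃w-cons c u)) (noConst-θ c (S̃w u))

-- The harmonic part is done on z-words: a list [a₁, …, aₙ] stands for z_{a₁+1} ⋯ z_{aₙ+1},
-- and z_{a+1} z_{b+1} merge into z_{(a ⊕ b)+1}.
ZPoly : Set
ZPoly = FS (List ℕ)

infixl 6 _⊕_
_⊕_ : ℕ → ℕ → ℕ
a ⊕ b = suc (a ℕ.+ b)

⊕-assoc : (a b c : ℕ) → (a ⊕ b) ⊕ c ≡ a ⊕ (b ⊕ c)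
⊕-assoc a b c = cong suc (trans (cong suc (ℕP.+-assoc a b c)) (sym (ℕP.+-suc a (b ℕ.+ c))))

⊕-comm : (a b : ℕ) → a ⊕ b ≡ b ⊕ a
⊕-comm a b = cong suc (ℕP.+-comm a b)

-- The two operators from which S̃ is built on z-words: prefix a puts z_{a+1} in front,
-- merge a merges z_{a+1} into the first letter (and kills the empty word).
prefix : ℕ → ZPoly → ZPoly
prefix a = mapFS (a ∷_)

mergew : ℕ → List ℕ → ZPoly
mergew a [] = []
mergew a (b ∷ u) = sing (a ⊕ b ∷ u)

merge : ℕ → ZPoly → ZPoly
merge a = lin (mergew a)

data Kind : Set where
  pre mrg : Kind

act : Kind → ℕ → ZPoly → ZPoly
act pre = prefix
act mrg = merge

-- The operator occurring in the merged term of the Leibniz rule: a merge only if both are.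
_⋄_ : Kind → Kind → Kind
mrg ⋄ mrg = mrg
pre ⋄ _ = pre
mrg ⋄ pre = pre

act-linear : (U : Kind) (a : ℕ) → Linear (act U a)
act-linear pre a = mapFS-linear (a ∷_)
act-linear mrg a = lin-linear (mergew a)

N̄ : ZPoly → ZPoly → ZPoly
N̄ = bilin nharZ

N̄-bilinear : Bilinear N̄
N̄-bilinear = bilin-bilinear nharZ

prefix-cong : {a b : ℕ} → a ≡ b → (P : ZPoly) → prefix a P ≐ prefix b P
prefix-cong refl P = ≐-refl

merge-prefix : (a c : ℕ) (P : ZPoly) → merge a (prefix c P) ≐ prefix (a ⊕ c) P
merge-prefix a c P = ≐-intro λ g → begin
  ev (merge a (prefix c P)) g              ≡⟨ ev-lin (mergew a) (prefix c P) g ⟩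
  ev (prefix c P) (λ u → ev (mergew a u) g) ≡⟨ ev-mapFS (c ∷_) P _ ⟩
  ev P (λ u → ev (sing (a ⊕ c ∷ u)) g)     ≡⟨ ev-cong P (λ u → ev-sing (a ⊕ c ∷ u) g) ⟩
  ev P (λ u → g (a ⊕ c ∷ u))               ≡⟨ sym (ev-mapFS (a ⊕ c ∷_) P g) ⟩
  ev (prefix (a ⊕ c) P) g                  ∎
  where open ≡-Reasoning

merge-merge : (a b : ℕ) (P : ZPoly) → merge a (merge b P) ≐ merge (a ⊕ b) P
merge-merge a b = linear-ext (∘-linear (act-linear mrg a) (act-linear mrg b)) (act-linear mrg (a ⊕ b)) on-word
  where
  on-word : (u : List ℕ) → merge a (merge b (sing u)) ≐ merge (a ⊕ b) (sing u)
  on-word [] = ≐-refl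
  on-word (c ∷ u) = begin
    merge a (merge b (sing (c ∷ u)))   ≈⟨ linear-cong (act-linear mrg a) (merge-prefix b c (sing u)) ⟩
    merge a (prefix (b ⊕ c) (sing u))  ≈⟨ merge-prefix a (b ⊕ c) (sing u) ⟩
    prefix (a ⊕ (b ⊕ c)) (sing u)      ≈⟨ prefix-cong (⊕-assoc a b c) (sing u) ⟨
    prefix ((a ⊕ b) ⊕ c) (sing u)      ≈⟨ merge-prefix (a ⊕ b) c (sing u) ⟨
    merge (a ⊕ b) (sing (c ∷ u))       ∎
    where open ≐-Reasoning

N̄-unitˡ : (Q : ZPoly) → N̄ (sing []) Q ≐ Q
N̄-unitˡ Q = ≐-trans (lin-sing (λ u → lin (nharZ u) Q) []) (lin-sing-id Q)

N̄-unitʳ : (P : ZPoly) → N̄ P (sing []) ≐ P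
N̄-unitʳ P = ≐-trans (lin-cong-fun (λ u → ≐-trans (lin-sing (nharZ u) []) (≡⇒≐ (unit u))) P) (lin-sing-id P)
  where
  unit : (u : List ℕ) → nharZ u [] ≡ sing u
  unit [] = refl
  unit (_ ∷ _) = refl

leibniz-rhs : (U V : Kind) (a b : ℕ) → ZPoly → ZPoly → ZPoly
leibniz-rhs U V a b X Y =
  act U a (N̄ X (act V b Y)) ++ (act V b (N̄ (act U a X) Y) ++ neg (act (U ⋄ V) (a ⊕ b) (N̄ X Y)))

leibniz-rhs-bilinear : (U V : Kind) (a b : ℕ) → Bilinear (leibniz-rhs U V a b)
leibniz-rhs-bilinear U V a b =
  ⊕-bilinear (∘-bilinear (act-linear U a) (bilinear-∘ N̄-bilinear id-linear (act-linear V b)))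
    (⊕-bilinear (∘-bilinear (act-linear V b) (bilinear-∘ N̄-bilinear (act-linear U a) id-linear))
      (∘-bilinear (∘-linear neg-linear (act-linear (U ⋄ V) (a ⊕ b))) N̄-bilinear))

Rule : Kind → Kind → Set
Rule U V = (a b : ℕ) (X Y : ZPoly) → N̄ (act U a X) (act V b Y) ≐ leibniz-rhs U V a b X Y

-- For two prefixes it is the defining recursion of ✶̄.
rule-pre-pre : Rule pre pre
rule-pre-pre a b =
  bilinear-ext (bilinear-∘ N̄-bilinear (act-linear pre a) (act-linear pre b)) (leibniz-rhs-bilinear pre pre a b) on-words
  where
  on-words : (x y : List ℕ) → N̄ (sing (a ∷ x)) (sing (b ∷ y)) ≐ leibniz-rhs pre pre a b (sing x) (sing y)
  on-words x y = ≐-trans (bilin-sing nharZ (a ∷ x) (b ∷ y))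
    (++-cong (linear-cong (act-linear pre a) (≐-sym (bilin-sing nharZ x (b ∷ y))))
      (++-cong (linear-cong (act-linear pre b) (≐-sym (bilin-sing nharZ (a ∷ x) y)))
        (linear-cong (∘-linear neg-linear (act-linear pre (a ⊕ b))) (≐-sym (bilin-sing nharZ x y)))))

merge-act : (a : ℕ) (V : Kind) (b : ℕ) (P : ZPoly) → merge a (act V b P) ≐ act (mrg ⋄ V) (a ⊕ b) P
merge-act a pre b P = merge-prefix a b P
merge-act a mrg b P = merge-merge a b P

merge-leibniz : (a c : ℕ) (V : Kind) (b : ℕ) (X Y : ZPoly) →
  merge a (leibniz-rhs pre V c b X Y) ≐
  prefix (a ⊕ c) (N̄ X (act V b Y)) ++
    (act (mrg ⋄ V) (a ⊕ b) (N̄ (prefix c X) Y) ++ neg (prefix (a ⊕ (c ⊕ b)) (N̄ X Y)))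
merge-leibniz a c V b X Y =
  ≐-trans (linear-++-neg (act-linear mrg a) (prefix c (N̄ X (act V b Y))) (act V b (N̄ (prefix c X) Y)) (prefix (c ⊕ b) (N̄ X Y)))
    (++-cong (merge-prefix a c (N̄ X (act V b Y)))
      (++-cong (merge-act a V b (N̄ (prefix c X) Y)) (linear-cong neg-linear (merge-prefix a (c ⊕ b) (N̄ X Y)))))

-- A rule with a merge on the left follows from the rule with a prefix on the left:
-- merge a sends z_{c+1} w to z_{(a ⊕ c)+1} w, and the empty word to 0.
rule-mrg-prefix : (V : Kind) → Rule pre V → (a b c : ℕ) (X Y : ZPoly) →
  N̄ (merge a (prefix c X)) (act V b Y) ≐ leibniz-rhs mrg V a b (prefix c X) Y
rule-mrg-prefix V rule-pre a b c X Y = begin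
  N̄ (merge a (prefix c X)) (act V b Y)
    ≈⟨ linear-cong (linearˡ N̄-bilinear (act V b Y)) (merge-prefix a c X) ⟩
  N̄ (prefix (a ⊕ c) X) (act V b Y)
    ≈⟨ rule-pre (a ⊕ c) b X Y ⟩
  prefix (a ⊕ c) D₁ ++ (act V b E ++ neg (prefix ((a ⊕ c) ⊕ b) D₃))
    ≈⟨ ++-congʳ (prefix (a ⊕ c) D₁) (++-congʳ (act V b E) (linear-cong neg-linear (prefix-cong (⊕-assoc a c b) D₃))) ⟩
  prefix (a ⊕ c) D₁ ++ (act V b E ++ neg (prefix (a ⊕ (c ⊕ b)) D₃))
    ≈⟨ lin-comb (v 0 ⊹ (v 3 ⊹ ⊟ v 2)) ((v 0 ⊹ (v 1 ⊹ ⊟ v 2)) ⊹ (v 3 ⊹ ⊟ v 1)) (λ _ → refl)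
                (prefix (a ⊕ c) D₁ ∷ act (mrg ⋄ V) (a ⊕ b) D₂ ∷ prefix (a ⊕ (c ⊕ b)) D₃ ∷ act V b E ∷ []) ⟩
  (prefix (a ⊕ c) D₁ ++ (act (mrg ⋄ V) (a ⊕ b) D₂ ++ neg (prefix (a ⊕ (c ⊕ b)) D₃))) ++
    (act V b E ++ neg (act (mrg ⋄ V) (a ⊕ b) D₂))
    ≈⟨ ++-cong (merge-leibniz a c V b X Y)
               (++-congˡ (linear-cong (act-linear V b) (linear-cong (linearˡ N̄-bilinear Y) (merge-prefix a c X))) _) ⟨
  merge a (leibniz-rhs pre V c b X Y) ++ (act V b (N̄ (merge a (prefix c X)) Y) ++ neg (act (mrg ⋄ V) (a ⊕ b) D₂))
    ≈⟨ ++-congˡ (linear-cong (act-linear mrg a) (rule-pre c b X Y)) _ ⟨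
  leibniz-rhs mrg V a b (prefix c X) Y ∎
  where
  open ≐-Reasoning
  D₁ = N̄ X (act V b Y)
  D₂ = N̄ (prefix c X) Y
  D₃ = N̄ X Y
  E = N̄ (prefix (a ⊕ c) X) Y

-- On the empty word both sides of a rule with a merge on the left vanish.
rule-mrg : (V : Kind) → Rule pre V → Rule mrg V
rule-mrg V rule-pre a b X Y =
  linear-ext (∘-linear (linearˡ N̄-bilinear (act V b Y)) (act-linear mrg a))
             (linearˡ (leibniz-rhs-bilinear mrg V a b) Y) on-word X
  where
  on-word : (u : List ℕ) → N̄ (merge a (sing u)) (act V b Y) ≐ leibniz-rhs mrg V a b (sing u) Y
  on-word [] = ≐-sym (begin
    merge a (N̄ (sing []) (act V b Y)) ++ (act V b [] ++ neg (act (mrg ⋄ V) (a ⊕ b) (N̄ (sing []) Y)))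
      ≈⟨ ++-cong (linear-cong (act-linear mrg a) (N̄-unitˡ (act V b Y)))
                 (++-cong (linear-[] (act-linear V b))
                          (linear-cong (∘-linear neg-linear (act-linear (mrg ⋄ V) (a ⊕ b))) (N̄-unitˡ Y))) ⟩
    merge a (act V b Y) ++ ([] ++ neg (act (mrg ⋄ V) (a ⊕ b) Y))
      ≈⟨ ++-congˡ (merge-act a V b Y) _ ⟩
    act (mrg ⋄ V) (a ⊕ b) Y ++ ([] ++ neg (act (mrg ⋄ V) (a ⊕ b) Y))
      ≈⟨ lin-comb (v 0 ⊹ (∅ ⊹ ⊟ v 0)) ∅ (λ _ → refl) (act (mrg ⋄ V) (a ⊕ b) Y ∷ []) ⟩
    [] ∎)
    where open ≐-Reasoning
  on-word (c ∷ x) = rule-mrg-prefix V rule-pre a b c (sing x) Y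

⊕-swap : (a b d : ℕ) → b ⊕ (a ⊕ d) ≡ a ⊕ (b ⊕ d)
⊕-swap a b d = trans (sym (⊕-assoc b a d)) (trans (cong (_⊕ d) (⊕-comm b a)) (⊕-assoc a b d))

rule-pre-mrg-prefix : (a b d : ℕ) (X Y : ZPoly) →
  N̄ (prefix a X) (merge b (prefix d Y)) ≐ leibniz-rhs pre mrg a b X (prefix d Y)
rule-pre-mrg-prefix a b d X Y = begin
  N̄ (prefix a X) (merge b (prefix d Y))
    ≈⟨ linear-cong (linearʳ N̄-bilinear (prefix a X)) (merge-prefix b d Y) ⟩
  N̄ (prefix a X) (prefix (b ⊕ d) Y)
    ≈⟨ rule-pre-pre a (b ⊕ d) X Y ⟩
  prefix a C₁′ ++ (prefix (b ⊕ d) C₂ ++ neg (prefix (a ⊕ (b ⊕ d)) C₃))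
    ≈⟨ lin-comb (v 0 ⊹ (v 2 ⊹ ⊟ v 3)) (v 0 ⊹ ((v 1 ⊹ (v 2 ⊹ ⊟ v 3)) ⊹ ⊟ v 1)) (λ _ → refl)
                (prefix a C₁′ ∷ prefix (a ⊕ b) C₁ ∷ prefix (b ⊕ d) C₂ ∷ prefix (a ⊕ (b ⊕ d)) C₃ ∷ []) ⟩
  prefix a C₁′ ++ ((prefix (a ⊕ b) C₁ ++ (prefix (b ⊕ d) C₂ ++ neg (prefix (a ⊕ (b ⊕ d)) C₃))) ++ neg (prefix (a ⊕ b) C₁))
    ≈⟨ ++-cong (linear-cong (act-linear pre a) (linear-cong (linearʳ N̄-bilinear X) (merge-prefix b d Y)))
               (++-congˡ merged _) ⟨
  leibniz-rhs pre mrg a b X (prefix d Y) ∎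
  where
  open ≐-Reasoning
  C₁ = N̄ X (prefix d Y)
  C₁′ = N̄ X (prefix (b ⊕ d) Y)
  C₂ = N̄ (prefix a X) Y
  C₃ = N̄ X Y
  merged : merge b (N̄ (prefix a X) (prefix d Y)) ≐
           prefix (a ⊕ b) C₁ ++ (prefix (b ⊕ d) C₂ ++ neg (prefix (a ⊕ (b ⊕ d)) C₃))
  merged = begin
    merge b (N̄ (prefix a X) (prefix d Y))
      ≈⟨ linear-cong (act-linear mrg b) (rule-pre-pre a d X Y) ⟩
    merge b (leibniz-rhs pre pre a d X Y)
      ≈⟨ merge-leibniz b a pre d X Y ⟩
    prefix (b ⊕ a) C₁ ++ (prefix (b ⊕ d) C₂ ++ neg (prefix (b ⊕ (a ⊕ d)) C₃))
      ≈⟨ ++-cong (prefix-cong (⊕-comm b a) C₁)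
                 (++-congʳ (prefix (b ⊕ d) C₂) (linear-cong neg-linear (prefix-cong (⊕-swap a b d) C₃))) ⟩
    prefix (a ⊕ b) C₁ ++ (prefix (b ⊕ d) C₂ ++ neg (prefix (a ⊕ (b ⊕ d)) C₃)) ∎

rule-pre-mrg : Rule pre mrg
rule-pre-mrg a b X Y =
  linear-ext (∘-linear (linearʳ N̄-bilinear (prefix a X)) (act-linear mrg b))
             (linearʳ (leibniz-rhs-bilinear pre mrg a b) X) on-word Y
  where
  on-word : (u : List ℕ) → N̄ (prefix a X) (merge b (sing u)) ≐ leibniz-rhs pre mrg a b X (sing u)
  on-word [] = begin
    N̄ (prefix a X) []
      ≈⟨ linear-[] (linearʳ N̄-bilinear (prefix a X)) ⟩
    []
      ≈⟨ lin-comb ∅ (∅ ⊹ (v 0 ⊹ ⊟ v 0)) (λ _ → refl) (prefix (a ⊕ b) X ∷ []) ⟩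
    [] ++ (prefix (a ⊕ b) X ++ neg (prefix (a ⊕ b) X))
      ≈⟨ ++-cong (linear-cong (act-linear pre a) (linear-[] (linearʳ N̄-bilinear X)))
                 (++-cong (≐-trans (linear-cong (act-linear mrg b) (N̄-unitʳ (prefix a X)))
                                   (≐-trans (merge-prefix b a X) (prefix-cong (⊕-comm b a) X)))
                          (linear-cong (∘-linear neg-linear (act-linear pre (a ⊕ b))) (N̄-unitʳ X))) ⟨
    leibniz-rhs pre mrg a b X (sing []) ∎
    where open ≐-Reasoning
  on-word (d ∷ y) = rule-pre-mrg-prefix a b d X (sing y)

rule : (U V : Kind) → Rule U V
rule pre pre = rule-pre-pre
rule pre mrg = rule-pre-mrg
rule mrg pre = rule-mrg pre rule-pre-pre
rule mrg mrg = rule-mrg mrg rule-pre-mrg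

-- S̃ on z-words: S̃ (z_{a+1} w) = Λ a (S̃ w) with Λ a = prefix a − merge a.
signs : FS Kind
signs = (1ℚ , pre) ∷ (- 1ℚ , mrg) ∷ []

Λ : ℕ → ZPoly → ZPoly
Λ a X = lin (λ U → act U a X) signs

Λ-linear : (a : ℕ) → Linear (Λ a)
Λ-linear a = family-linear (λ U → act-linear U a) signs

-- T l is S̃ of the z-word l, in z-coordinates (S̃w-zWord).
T : List ℕ → ZPoly
T [] = sing []
T (a ∷ u) = Λ a (T u)

signs-⋄ : (c : ℕ) (Z : ZPoly) → bilin (λ U V → neg (act (U ⋄ V) c Z)) signs signs ≐ Λ c Z
signs-⋄ c Z = ≐-intro λ g → begin
  ev (bilin (λ U V → neg (act (U ⋄ V) c Z)) signs signs) g
    ≡⟨ ev-bilin (λ U V → neg (act (U ⋄ V) c Z)) signs signs g ⟩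
  ev signs (λ U → ev signs (λ V → ev (neg (act (U ⋄ V) c Z)) g))
    ≡⟨ ev-cong signs (λ U → ev-cong signs (λ V → ev-neg (act (U ⋄ V) c Z) g)) ⟩
  ev signs (λ U → ev signs (λ V → - ev (act (U ⋄ V) c Z) g))
    ≡⟨ identity (ev (prefix c Z) g) (ev (merge c Z) g) ⟩
  ev signs (λ U → ev (act U c Z) g)
    ≡⟨ sym (ev-lin (λ U → act U c Z) signs g) ⟩
  ev (Λ c Z) g ∎
  where
  open ≡-Reasoning
  identity : ∀ p m → 1ℚ * (1ℚ * - p + (- 1ℚ * - p + 0ℚ)) + (- 1ℚ * (1ℚ * - p + (- 1ℚ * - m + 0ℚ)) + 0ℚ)
                   ≡ 1ℚ * p + (- 1ℚ * m + 0ℚ)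
  identity = solve-∀ ℚ-ring

Λ-leibniz : (a b : ℕ) (X Y : ZPoly) →
  N̄ (Λ a X) (Λ b Y) ≐ Λ a (N̄ X (Λ b Y)) ++ (Λ b (N̄ (Λ a X) Y) ++ Λ (a ⊕ b) (N̄ X Y))
Λ-leibniz a b X Y =
  ≐-trans (leibniz-extend nharZ (λ U → act U a) (λ U → act-linear U a) (λ V → act V b) (λ V → act-linear V b)
             X Y (λ U V → neg (act (U ⋄ V) (a ⊕ b) (N̄ X Y))) (λ U V → rule U V a b X Y) signs signs)
    (++-congʳ (Λ a (N̄ X (Λ b Y))) (++-congʳ (Λ b (N̄ (Λ a X) Y)) (signs-⋄ (a ⊕ b) (N̄ X Y))))

T-prefix : (a : ℕ) (H : ZPoly) → lin T (prefix a H) ≐ Λ a (lin T H)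
T-prefix a = lin-mapFS-hom T T (a ∷_) (Λ-linear a) (λ _ → ≐-refl)

T-harmonic : (l m : List ℕ) → lin T (harZ l m) ≐ N̄ (T l) (T m)
T-harmonic [] m = ≐-trans (lin-sing T m) (≐-sym (N̄-unitˡ (T m)))
T-harmonic (a ∷ u) [] = ≐-trans (lin-sing T (a ∷ u)) (≐-sym (N̄-unitʳ (T (a ∷ u))))
T-harmonic (a ∷ u) (b ∷ w) = begin
  lin T (prefix a H₁ ++ (prefix b H₂ ++ prefix (a ⊕ b) H₃))
    ≈⟨ ≐-trans (linear-++ (lin-linear T) (prefix a H₁) _) (++-congʳ (lin T (prefix a H₁)) (linear-++ (lin-linear T) (prefix b H₂) _)) ⟩
  lin T (prefix a H₁) ++ (lin T (prefix b H₂) ++ lin T (prefix (a ⊕ b) H₃))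
    ≈⟨ ++-cong (T-prefix a H₁) (++-cong (T-prefix b H₂) (T-prefix (a ⊕ b) H₃)) ⟩
  Λ a (lin T H₁) ++ (Λ b (lin T H₂) ++ Λ (a ⊕ b) (lin T H₃))
    ≈⟨ ++-cong (linear-cong (Λ-linear a) (T-harmonic u (b ∷ w)))
         (++-cong (linear-cong (Λ-linear b) (T-harmonic (a ∷ u) w)) (linear-cong (Λ-linear (a ⊕ b)) (T-harmonic u w))) ⟩
  Λ a (N̄ (T u) (Λ b (T w))) ++ (Λ b (N̄ (Λ a (T u)) (T w)) ++ Λ (a ⊕ b) (N̄ (T u) (T w)))
    ≈⟨ Λ-leibniz a b (T u) (T w) ⟨
  N̄ (T (a ∷ u)) (T (b ∷ w)) ∎
  where
  open ≐-Reasoning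
  H₁ = harZ u (b ∷ w)
  H₂ = harZ (a ∷ u) w
  H₃ = harZ u w

-- Translation to words: xs a = x^a, so that z_{a+1} w = x^a y w.
xs : ℕ → Word
xs a = replicate a 𝕩

xs-prefix : ℕ → Poly → Poly
xs-prefix a = mapFS (xs a ++_)

xs-suc : (n : ℕ) (R : Word) → xs (suc n) ++ R ≡ xs n ++ 𝕩 ∷ R
xs-suc zero R = refl
xs-suc (suc n) R = cong (𝕩 ∷_) (xs-suc n R)

xs-⊕ : (a b : ℕ) (R : Word) → xs (a ⊕ b) ++ R ≡ xs a ++ 𝕩 ∷ (xs b ++ R)
xs-⊕ zero b R = refl
xs-⊕ (suc a) b R = cong (𝕩 ∷_) (xs-⊕ a b R)

S̃w-xs : (a : ℕ) (c : Letter) (V : Word) → S̃w (xs a ++ c ∷ V) ≐ xs-prefix a (S̃w (c ∷ V))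
S̃w-xs zero c V = ≐-sym (mapFS-id (S̃w (c ∷ V)))
S̃w-xs (suc a) c V = begin
  S̃w (𝕩 ∷ (xs a ++ c ∷ V))                ≈⟨ S̃w-cons 𝕩 (xs a ++ c ∷ V) ⟩
  lmul 𝕩 (pos (S̃w (xs a ++ c ∷ V)))       ≈⟨ linear-cong (lmul-linear 𝕩) (noConst-S̃w′ a) ⟩
  lmul 𝕩 (S̃w (xs a ++ c ∷ V))             ≈⟨ linear-cong (lmul-linear 𝕩) (S̃w-xs a c V) ⟩
  lmul 𝕩 (xs-prefix a (S̃w (c ∷ V)))       ≈⟨ mapFS-∘ (𝕩 ∷_) (xs a ++_) (S̃w (c ∷ V)) ⟩
  xs-prefix (suc a) (S̃w (c ∷ V))          ∎
  where
  open ≐-Reasoning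
  noConst-S̃w′ : (a : ℕ) → NoConst (S̃w (xs a ++ c ∷ V))
  noConst-S̃w′ zero = noConst-S̃w c V
  noConst-S̃w′ (suc a) = noConst-S̃w 𝕩 (xs a ++ c ∷ V)

zWord-prefix : (a : ℕ) (P : ZPoly) → mapFS zWord (prefix a P) ≐ xs-prefix a (lmul 𝕪 (mapFS zWord P))
zWord-prefix a P = ≐-trans (mapFS-∘ zWord (a ∷_) P) (≐-sym (≐-trans (mapFS-∘ (xs a ++_) (𝕪 ∷_) (mapFS zWord P)) (mapFS-∘ _ zWord P)))

zWord-merge : (a : ℕ) (P : ZPoly) → mapFS zWord (merge a P) ≐ xs-prefix a (lmul 𝕩 (pos (mapFS zWord P)))
zWord-merge a = linear-ext (∘-linear (mapFS-linear zWord) (act-linear mrg a))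
  (∘-linear (mapFS-linear (xs a ++_)) (∘-linear (lmul-linear 𝕩) (∘-linear pos-linear (mapFS-linear zWord)))) on-word
  where
  on-word : (l : List ℕ) → mapFS zWord (merge a (sing l)) ≐ xs-prefix a (lmul 𝕩 (pos (sing (zWord l))))
  on-word [] = ≐-refl
  on-word (b ∷ l) = begin
    mapFS zWord (merge a (sing (b ∷ l)))        ≈⟨ linear-cong (mapFS-linear zWord) (lin-sing (mergew a) (b ∷ l)) ⟩
    sing (xs (a ⊕ b) ++ 𝕪 ∷ zWord l)           ≡⟨ cong sing (xs-⊕ a b (𝕪 ∷ zWord l)) ⟩
    sing (xs a ++ 𝕩 ∷ zWord (b ∷ l))           ≈⟨ linear-cong (∘-linear (mapFS-linear (xs a ++_)) (lmul-linear 𝕩)) (posw-zWord b l) ⟨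
    xs-prefix a (lmul 𝕩 (pos (sing (zWord (b ∷ l))))) ∎
    where
    open ≐-Reasoning
    posw-zWord : (b : ℕ) (l : List ℕ) → pos (sing (zWord (b ∷ l))) ≐ sing (zWord (b ∷ l))
    posw-zWord zero l = lin-sing posw (𝕪 ∷ zWord l)
    posw-zWord (suc b) l = lin-sing posw (𝕩 ∷ (xs b ++ 𝕪 ∷ zWord l))

Λ-expand : (a : ℕ) (X : ZPoly) → Λ a X ≐ prefix a X ++ neg (merge a X)
Λ-expand a X = ≐-intro λ g → begin
  ev (Λ a X) g                                 ≡⟨ ev-lin (λ U → act U a X) signs g ⟩
  1ℚ * ev (prefix a X) g + (- 1ℚ * ev (merge a X) g + 0ℚ)
    ≡⟨ identity (ev (prefix a X) g) (ev (merge a X) g) ⟩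
  ev (prefix a X) g + - ev (merge a X) g       ≡⟨ cong (ev (prefix a X) g +_) (sym (ev-neg (merge a X) g)) ⟩
  ev (prefix a X) g + ev (neg (merge a X)) g   ≡⟨ sym (ev-++ (prefix a X) (neg (merge a X)) g) ⟩
  ev (prefix a X ++ neg (merge a X)) g         ∎
  where
  open ≡-Reasoning
  identity : ∀ p m → 1ℚ * p + (- 1ℚ * m + 0ℚ) ≡ p + - m
  identity = solve-∀ ℚ-ring

S̃w-zWord : (l : List ℕ) → S̃w (zWord l) ≐ mapFS zWord (T l)
S̃w-zWord [] = ≐-refl
S̃w-zWord (a ∷ u) = begin
  S̃w (xs a ++ 𝕪 ∷ zWord u)                               ≈⟨ S̃w-xs a 𝕪 (zWord u) ⟩
  xs-prefix a (S̃w (𝕪 ∷ zWord u))                         ≈⟨ linear-cong (mapFS-linear (xs a ++_)) (S̃w-cons 𝕪 (zWord u)) ⟩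
  xs-prefix a (θ 𝕪 (S̃w (zWord u)))                       ≈⟨ linear-cong (∘-linear (mapFS-linear (xs a ++_)) (θ-linear 𝕪)) (S̃w-zWord u) ⟩
  xs-prefix a (lmul 𝕪 Z ++ neg (lmul 𝕩 (pos Z)))          ≈⟨ linear-minus (mapFS-linear (xs a ++_)) (lmul 𝕪 Z) (lmul 𝕩 (pos Z)) ⟩
  xs-prefix a (lmul 𝕪 Z) ++ neg (xs-prefix a (lmul 𝕩 (pos Z)))
    ≈⟨ ++-cong (zWord-prefix a (T u)) (linear-cong neg-linear (zWord-merge a (T u))) ⟨
  mapFS zWord (prefix a (T u)) ++ neg (mapFS zWord (merge a (T u)))
    ≈⟨ linear-minus (mapFS-linear zWord) (prefix a (T u)) (merge a (T u)) ⟨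
  mapFS zWord (prefix a (T u) ++ neg (merge a (T u)))     ≈⟨ linear-cong (mapFS-linear zWord) (Λ-expand a (T u)) ⟨
  mapFS zWord (Λ a (T u))                                ∎
  where
  open ≐-Reasoning
  Z = mapFS zWord (T u)

parseZ-xs : (n a : ℕ) (V : Word) → parseZ n (xs a ++ V) ≡ parseZ (a ℕ.+ n) V
parseZ-xs n zero V = refl
parseZ-xs n (suc a) V =
  trans (parseZ-x n) (trans (parseZ-xs (suc n) a V) (cong (λ k → parseZ k V) (ℕP.+-suc a n)))
  where
  parseZ-x : (n : ℕ) → parseZ n (𝕩 ∷ xs a ++ V) ≡ parseZ (suc n) (xs a ++ V)
  parseZ-x zero = refl
  parseZ-x (suc n) = refl

parseZ-zWord : (l : List ℕ) → parseZ zero (zWord l) ≡ just l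
parseZ-zWord [] = refl
parseZ-zWord (a ∷ l) = begin
  parseZ zero (xs a ++ 𝕪 ∷ zWord l)   ≡⟨ parseZ-xs zero a (𝕪 ∷ zWord l) ⟩
  parseZ (a ℕ.+ zero) (𝕪 ∷ zWord l)   ≡⟨ cong (λ k → parseZ k (𝕪 ∷ zWord l)) (ℕP.+-identityʳ a) ⟩
  parseZ a (𝕪 ∷ zWord l)              ≡⟨ parseZ-y a ⟩
  just (a ∷ l)                        ∎
  where
  open ≡-Reasoning
  parseZ-y : (n : ℕ) → parseZ n (𝕪 ∷ zWord l) ≡ just (n ∷ l)
  parseZ-y zero rewrite parseZ-zWord l = refl
  parseZ-y (suc n) rewrite parseZ-zWord l = refl

H1-zWord : (w : Word) → H1Word w → ∃ λ l → zWord l ≡ w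
H1-zWord .[] (inj₁ refl) = [] , refl
H1-zWord .(F ++ 𝕪 ∷ []) (inj₂ (F , refl)) = shifted zero F
  where
  shifted : (n : ℕ) (F : Word) → ∃ λ l → zWord l ≡ xs n ++ F ++ 𝕪 ∷ []
  shifted n [] = n ∷ [] , refl
  shifted n (𝕩 ∷ F) with shifted (suc n) F
  ... | l , e = l , trans e (xs-suc n (F ++ 𝕪 ∷ []))
  shifted n (𝕪 ∷ F) with shifted zero F
  ... | l , e = n ∷ l , cong (λ w → xs n ++ 𝕪 ∷ w) e

zWord-bilin : (f : List ℕ → List ℕ → ZPoly) (P Q : ZPoly) →
              mapFS zWord (bilin f P Q) ≐ bilin (liftZ f) (mapFS zWord P) (mapFS zWord Q)
zWord-bilin f P Q = ≐-intro λ g → begin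
  ev (mapFS zWord (bilin f P Q)) g
    ≡⟨ ev-mapFS zWord (bilin f P Q) g ⟩
  ev (bilin f P Q) (λ w → g (zWord w))
    ≡⟨ ev-bilin f P Q _ ⟩
  ev P (λ l → ev Q (λ m → ev (f l m) (λ w → g (zWord w))))
    ≡⟨ ev-cong P (λ l → ev-cong Q (λ m → sym (on-words l m g))) ⟩
  ev P (λ l → ev Q (λ m → ev (liftZ f (zWord l) (zWord m)) g))
    ≡⟨ sym (trans (ev-bilin (liftZ f) (mapFS zWord P) (mapFS zWord Q) g)
                  (trans (ev-mapFS zWord P _) (ev-cong P (λ l → ev-mapFS zWord Q _)))) ⟩
  ev (bilin (liftZ f) (mapFS zWord P) (mapFS zWord Q)) g ∎
  where
  open ≡-Reasoning
  on-words : (l m : List ℕ) (g : Word → ℚ) → ev (liftZ f (zWord l) (zWord m)) g ≡ ev (f l m) (λ w → g (zWord w))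
  on-words l m g rewrite parseZ-zWord l | parseZ-zWord m = ev-mapFS zWord (f l m) g

S̃-harmonic-zWord : (l m : List ℕ) →
  S̃ (liftZ harZ (zWord l) (zWord m)) ≐ bilin (liftZ nharZ) (S̃w (zWord l)) (S̃w (zWord m))
S̃-harmonic-zWord l m rewrite parseZ-zWord l | parseZ-zWord m = begin
  S̃ (mapFS zWord (harZ l m))                       ≈⟨ lin-mapFS S̃w zWord (harZ l m) ⟩
  lin (λ k → S̃w (zWord k)) (harZ l m)              ≈⟨ lin-cong-fun S̃w-zWord (harZ l m) ⟩
  lin (λ k → mapFS zWord (T k)) (harZ l m)         ≈⟨ linear-lin (mapFS-linear zWord) T (harZ l m) ⟨
  mapFS zWord (lin T (harZ l m))                   ≈⟨ linear-cong (mapFS-linear zWord) (T-harmonic l m) ⟩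
  mapFS zWord (N̄ (T l) (T m))                      ≈⟨ zWord-bilin nharZ (T l) (T m) ⟩
  bilin (liftZ nharZ) (mapFS zWord (T l)) (mapFS zWord (T m))
    ≈⟨ bilin-cong (liftZ nharZ) (S̃w-zWord l) (S̃w-zWord m) ⟨
  bilin (liftZ nharZ) (S̃w (zWord l)) (S̃w (zWord m)) ∎
  where open ≐-Reasoning

S̃-harmonic-word : (u w : Word) → H1Word u → H1Word w →
  S̃ (liftZ harZ u w) ≐ bilin (liftZ nharZ) (S̃w u) (S̃w w)
S̃-harmonic-word u w hu hw with H1-zWord u hu | H1-zWord w hw
... | l , refl | m , refl = S̃-harmonic-zWord l m

S̃-harmonic : (p q : Poly) → InH1 p → InH1 q → S̃ (p ✶ q) ≈ S̃ p ✶̄ S̃ q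
S̃-harmonic p q hp hq = begin
  S̃ (p ✶ q)                                                ≈⟨ ≐⇒≈ (linear-bilin (lin-linear S̃w) (liftZ harZ) p q) ⟩
  bilin (λ u w → S̃ (liftZ harZ u w)) p q                   ≈⟨ bilin-on-H1 p q hp hq S̃-harmonic-word ⟩
  bilin (λ u w → bilin (liftZ nharZ) (S̃w u) (S̃w w)) p q    ≈⟨ ≐⇒≈ (bilin-lin (liftZ nharZ) S̃w S̃w p q) ⟨
  S̃ p ✶̄ S̃ q                                               ∎
  where open ≈-Reasoning

B̄ : Poly → Poly → Poly
B̄ = bilin nshw

B̄-bilinear : Bilinear B̄
B̄-bilinear = bilin-bilinear nshw

B̄-unitˡ : (Q : Poly) → B̄ (sing []) Q ≐ Q
B̄-unitˡ Q = ≐-trans (lin-sing (λ u → lin (nshw u) Q) []) (lin-sing-id Q)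

B̄-unitʳ : (P : Poly) → B̄ P (sing []) ≐ P
B̄-unitʳ P = ≐-trans (lin-cong-fun (λ u → ≐-trans (lin-sing (nshw u) []) (≡⇒≐ (unit u))) P) (lin-sing-id P)
  where
  unit : (u : Word) → nshw u [] ≡ sing u
  unit [] = refl
  unit (_ ∷ _) = refl

noConst-ext : {F G : Poly → Poly} → Linear F → Linear G →
              (∀ c t → F (sing (c ∷ t)) ≐ G (sing (c ∷ t))) → {X : Poly} → NoConst X → F X ≐ G X
noConst-ext {F} {G} LF LG agree {X} nc = begin
  F X                            ≈⟨ linear-cong LF nc ⟨
  F (pos X)                      ≈⟨ linear-lin LF posw X ⟩
  lin (λ u → F (posw u)) X       ≈⟨ lin-cong-fun on-word X ⟩
  lin (λ u → G (posw u)) X       ≈⟨ linear-lin LG posw X ⟨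
  G (pos X)                      ≈⟨ linear-cong LG nc ⟩
  G X                            ∎
  where
  open ≐-Reasoning
  on-word : (u : Word) → F (posw u) ≐ G (posw u)
  on-word [] = ≐-trans (linear-[] LF) (≐-sym (linear-[] LG))
  on-word (c ∷ t) = agree c t

noConst-nshw : (c : Letter) (s t : Word) → NoConst (nshw (c ∷ s) t)
noConst-nshw c s [] = lin-sing posw (c ∷ s)
noConst-nshw c s (d ∷ t) =
  ≐-trans (linear-++ pos-linear (lmul c (nshw s (d ∷ t))) _)
    (++-cong (noConst-lmul c (nshw s (d ∷ t)))
      (≐-trans (linear-++ pos-linear (lmul d (nshw (c ∷ s) t)) _)
        (++-cong (noConst-lmul d (nshw (c ∷ s) t))
          (≐-trans (linear-++ pos-linear (corr s c (d ∷ t)) _) (++-cong (noConst-corr s c _) (noConst-corr t d _))))))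
  where
  noConst-corr : (s : Word) (a : Letter) (w : Word) → NoConst (corr s a w)
  noConst-corr [] a w = ≐-intro λ g → refl
  noConst-corr (_ ∷ _) a w = ≐-refl

noConst-B̄ : {X : Poly} (Z : Poly) → NoConst X → NoConst (B̄ X Z)
noConst-B̄ Z = noConst-ext (∘-linear pos-linear (linearˡ B̄-bilinear Z)) (linearˡ B̄-bilinear Z) on-word
  where
  on-word : (c : Letter) (s : Word) → pos (B̄ (sing (c ∷ s)) Z) ≐ B̄ (sing (c ∷ s)) Z
  on-word c s = begin
    pos (B̄ (sing (c ∷ s)) Z)            ≈⟨ linear-cong pos-linear (lin-sing (λ u → lin (nshw u) Z) (c ∷ s)) ⟩
    pos (lin (nshw (c ∷ s)) Z)           ≈⟨ linear-lin pos-linear (nshw (c ∷ s)) Z ⟩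
    lin (λ t → pos (nshw (c ∷ s) t)) Z   ≈⟨ lin-cong-fun (noConst-nshw c s) Z ⟩
    lin (nshw (c ∷ s)) Z                 ≈⟨ lin-sing (λ u → lin (nshw u) Z) (c ∷ s) ⟨
    B̄ (sing (c ∷ s)) Z                   ∎
    where open ≐-Reasoning

noConst-ext₂ : {β β′ : Poly → Poly → Poly} → Bilinear β → Bilinear β′ →
               (∀ c s d t → β (sing (c ∷ s)) (sing (d ∷ t)) ≐ β′ (sing (c ∷ s)) (sing (d ∷ t))) →
               {X Y : Poly} → NoConst X → NoConst Y → β X Y ≐ β′ X Y
noConst-ext₂ Lβ Lβ′ agree {X} {Y} ncX ncY =
  noConst-ext (linearˡ Lβ Y) (linearˡ Lβ′ Y)
    (λ c s → noConst-ext (linearʳ Lβ (sing (c ∷ s))) (linearʳ Lβ′ (sing (c ∷ s))) (agree c s) ncY) ncX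

-- S₂(a) as a formal combination of letters; for X without constant term, θ a X is
-- left multiplication by it.
ℓ : Letter → FS Letter
ℓ 𝕩 = sing 𝕩
ℓ 𝕪 = (1ℚ , 𝕪) ∷ (- 1ℚ , 𝕩) ∷ []

lmulℓ : FS Letter → Poly → Poly
lmulℓ m P = lin (λ c → lmul c P) m

lmulℓ-linear : (m : FS Letter) → Linear (lmulℓ m)
lmulℓ-linear m = family-linear lmul-linear m

θ-ℓ : (a : Letter) {X : Poly} → NoConst X → θ a X ≐ lmulℓ (ℓ a) X
θ-ℓ 𝕩 {X} nc = ≐-trans (θ-σ₂ 𝕩 nc) (≐-sym (lin-sing (λ c → lmul c X) 𝕩))
θ-ℓ 𝕪 {X} nc = ≐-trans (θ-σ₂ 𝕪 nc) (≐-intro λ g → begin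
  ev (lmul 𝕪 X ++ neg (lmul 𝕩 X)) g          ≡⟨ ev-++ (lmul 𝕪 X) (neg (lmul 𝕩 X)) g ⟩
  ev (lmul 𝕪 X) g + ev (neg (lmul 𝕩 X)) g    ≡⟨ cong (ev (lmul 𝕪 X) g +_) (ev-neg (lmul 𝕩 X) g) ⟩
  ev (lmul 𝕪 X) g + - ev (lmul 𝕩 X) g        ≡⟨ identity (ev (lmul 𝕪 X) g) (ev (lmul 𝕩 X) g) ⟩
  ev (ℓ 𝕪) (λ c → ev (lmul c X) g)           ≡⟨ sym (ev-lin (λ c → lmul c X) (ℓ 𝕪) g) ⟩
  ev (lmulℓ (ℓ 𝕪) X) g                       ∎)
  where
  open ≡-Reasoning
  identity : ∀ y x → y + - x ≡ 1ℚ * y + (- 1ℚ * x + 0ℚ)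
  identity = solve-∀ ℚ-ring

shuffle-leibniz : (c d : Letter) {X Y : Poly} → NoConst X → NoConst Y →
  B̄ (lmul c X) (lmul d Y) ≐ lmul c (B̄ X (lmul d Y)) ++ (lmul d (B̄ (lmul c X) Y) ++ [])
shuffle-leibniz c d =
  noConst-ext₂ (bilinear-∘ B̄-bilinear (lmul-linear c) (lmul-linear d))
    (⊕-bilinear (∘-bilinear (lmul-linear c) (bilinear-∘ B̄-bilinear id-linear (lmul-linear d)))
      (⊕-bilinear (∘-bilinear (lmul-linear d) (bilinear-∘ B̄-bilinear (lmul-linear c) id-linear)) zero-bilinear))
    on-words
  where
  on-words : (c′ : Letter) (s : Word) (d′ : Letter) (t : Word) →
    B̄ (sing (c ∷ c′ ∷ s)) (sing (d ∷ d′ ∷ t)) ≐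
    lmul c (B̄ (sing (c′ ∷ s)) (sing (d ∷ d′ ∷ t))) ++ (lmul d (B̄ (sing (c ∷ c′ ∷ s)) (sing (d′ ∷ t))) ++ [])
  on-words c′ s d′ t = ≐-trans (bilin-sing nshw (c ∷ c′ ∷ s) (d ∷ d′ ∷ t))
    (++-cong (linear-cong (lmul-linear c) (≐-sym (bilin-sing nshw (c′ ∷ s) (d ∷ d′ ∷ t))))
             (++-congˡ (linear-cong (lmul-linear d) (≐-sym (bilin-sing nshw (c ∷ c′ ∷ s) (d′ ∷ t)))) []))

shuffle-leibniz-letterˡ : (c d : Letter) {Y : Poly} → NoConst Y →
  B̄ (lmul c (sing [])) (lmul d Y) ≐
  lmul c (B̄ (sing []) (lmul d Y)) ++ (lmul d (B̄ (lmul c (sing [])) Y) ++ neg (lmul (τ c) (lmul d Y)))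
shuffle-leibniz-letterˡ c d =
  noConst-ext (∘-linear (linearʳ B̄-bilinear (sing (c ∷ []))) (lmul-linear d))
    (⊕-linear (∘-linear (lmul-linear c) (∘-linear (linearʳ B̄-bilinear (sing [])) (lmul-linear d)))
      (⊕-linear (∘-linear (lmul-linear d) (linearʳ B̄-bilinear (sing (c ∷ []))))
        (∘-linear neg-linear (∘-linear (lmul-linear (τ c)) (lmul-linear d)))))
    on-word
  where
  on-word : (d′ : Letter) (t : Word) →
    B̄ (sing (c ∷ [])) (sing (d ∷ d′ ∷ t)) ≐
    lmul c (B̄ (sing []) (sing (d ∷ d′ ∷ t))) ++ (lmul d (B̄ (sing (c ∷ [])) (sing (d′ ∷ t))) ++ neg (sing (τ c ∷ d ∷ d′ ∷ t)))
  on-word d′ t = ≐-trans (bilin-sing nshw (c ∷ []) (d ∷ d′ ∷ t))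
    (++-cong (linear-cong (lmul-linear c) (≐-sym (bilin-sing nshw [] (d ∷ d′ ∷ t))))
             (++-congˡ (linear-cong (lmul-linear d) (≐-sym (bilin-sing nshw (c ∷ []) (d′ ∷ t)))) _))

shuffle-leibniz-letterʳ : (c d : Letter) {X : Poly} → NoConst X →
  B̄ (lmul c X) (lmul d (sing [])) ≐
  lmul c (B̄ X (lmul d (sing []))) ++ (lmul d (B̄ (lmul c X) (sing [])) ++ neg (lmul (τ d) (lmul c X)))
shuffle-leibniz-letterʳ c d =
  noConst-ext (∘-linear (linearˡ B̄-bilinear (sing (d ∷ []))) (lmul-linear c))
    (⊕-linear (∘-linear (lmul-linear c) (linearˡ B̄-bilinear (sing (d ∷ []))))
      (⊕-linear (∘-linear (lmul-linear d) (∘-linear (linearˡ B̄-bilinear (sing [])) (lmul-linear c)))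
        (∘-linear neg-linear (∘-linear (lmul-linear (τ d)) (lmul-linear c)))))
    on-word
  where
  on-word : (c′ : Letter) (s : Word) →
    B̄ (sing (c ∷ c′ ∷ s)) (sing (d ∷ [])) ≐
    lmul c (B̄ (sing (c′ ∷ s)) (sing (d ∷ []))) ++ (lmul d (B̄ (sing (c ∷ c′ ∷ s)) (sing [])) ++ neg (sing (τ d ∷ c ∷ c′ ∷ s)))
  on-word c′ s = ≐-trans (bilin-sing nshw (c ∷ c′ ∷ s) (d ∷ []))
    (++-cong (linear-cong (lmul-linear c) (≐-sym (bilin-sing nshw (c′ ∷ s) (d ∷ []))))
             (++-congˡ (linear-cong (lmul-linear d) (≐-sym (bilin-sing nshw (c ∷ c′ ∷ s) []))) _))

-- θ distributes over ⧢̄ like a derivation, in the four cases allowed in 𝔥¹: both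
-- factors nonempty, or either one equal to the word y (written y₁).
θ-leibniz-NN : (a b : Letter) {X Y : Poly} → NoConst X → NoConst Y →
  B̄ (θ a X) (θ b Y) ≐ θ a (B̄ X (θ b Y)) ++ θ b (B̄ (θ a X) Y)
θ-leibniz-NN a b {X} {Y} ncX ncY = begin
  B̄ (θ a X) (θ b Y)
    ≈⟨ bilin-cong nshw (θ-ℓ a ncX) (θ-ℓ b ncY) ⟩
  B̄ (lmulℓ (ℓ a) X) (lmulℓ (ℓ b) Y)
    ≈⟨ leibniz-extend nshw lmul lmul-linear lmul lmul-linear X Y (λ _ _ → [])
         (λ c d → shuffle-leibniz c d ncX ncY) (ℓ a) (ℓ b) ⟩
  lmulℓ (ℓ a) (B̄ X (lmulℓ (ℓ b) Y)) ++ (lmulℓ (ℓ b) (B̄ (lmulℓ (ℓ a) X) Y) ++ bilin (λ _ _ → []) (ℓ a) (ℓ b))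
    ≈⟨ ++-congʳ (lmulℓ (ℓ a) (B̄ X (lmulℓ (ℓ b) Y)))
         (≐-trans (++-congʳ (lmulℓ (ℓ b) (B̄ (lmulℓ (ℓ a) X) Y)) (bilin-zero (ℓ a) (ℓ b))) (≡⇒≐ (ListP.++-identityʳ _))) ⟩
  lmulℓ (ℓ a) (B̄ X (lmulℓ (ℓ b) Y)) ++ lmulℓ (ℓ b) (B̄ (lmulℓ (ℓ a) X) Y)
    ≈⟨ ++-cong left right ⟩
  θ a (B̄ X (θ b Y)) ++ θ b (B̄ (θ a X) Y) ∎
  where
  open ≐-Reasoning
  left : lmulℓ (ℓ a) (B̄ X (lmulℓ (ℓ b) Y)) ≐ θ a (B̄ X (θ b Y))
  left = ≐-trans (linear-cong (lmulℓ-linear (ℓ a)) (linear-cong (linearʳ B̄-bilinear X) (≐-sym (θ-ℓ b ncY))))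
                 (≐-sym (θ-ℓ a (noConst-B̄ (θ b Y) ncX)))
  right : lmulℓ (ℓ b) (B̄ (lmulℓ (ℓ a) X) Y) ≐ θ b (B̄ (θ a X) Y)
  right = ≐-trans (linear-cong (lmulℓ-linear (ℓ b)) (linear-cong (linearˡ B̄-bilinear Y) (≐-sym (θ-ℓ a ncX))))
                  (≐-sym (θ-ℓ b (noConst-B̄ Y (noConst-θ a X))))

y₁ : Poly
y₁ = sing (𝕪 ∷ [])

θ-leibniz-yN : (b : Letter) {Y : Poly} → NoConst Y →
  B̄ y₁ (θ b Y) ≐ θ 𝕪 (B̄ (sing []) (θ b Y)) ++ θ b (B̄ y₁ Y)
θ-leibniz-yN b {Y} ncY = begin
  B̄ y₁ (θ b Y)
    ≈⟨ bilin-cong nshw (≐-sym (lin-sing (λ c → lmul c (sing [])) 𝕪)) (θ-ℓ b ncY) ⟩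
  B̄ (lmulℓ (sing 𝕪) (sing [])) Z
    ≈⟨ leibniz-extend nshw lmul lmul-linear lmul lmul-linear (sing []) Y R
         (λ c d → shuffle-leibniz-letterˡ c d ncY) (sing 𝕪) (ℓ b) ⟩
  lmulℓ (sing 𝕪) (B̄ (sing []) Z) ++ (lmulℓ (ℓ b) (B̄ (lmulℓ (sing 𝕪) (sing [])) Y) ++ bilin R (sing 𝕪) (ℓ b))
    ≈⟨ ++-cong first (++-cong second third) ⟩
  lmul 𝕪 Z ++ (θ b (B̄ y₁ Y) ++ neg (lmul 𝕩 Z))
    ≈⟨ lin-comb (v 0 ⊹ (v 2 ⊹ ⊟ v 1)) ((v 0 ⊹ ⊟ v 1) ⊹ v 2) (λ _ → refl) (lmul 𝕪 Z ∷ lmul 𝕩 Z ∷ θ b (B̄ y₁ Y) ∷ []) ⟩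
  (lmul 𝕪 Z ++ neg (lmul 𝕩 Z)) ++ θ b (B̄ y₁ Y)
    ≈⟨ ++-congˡ fourth (θ b (B̄ y₁ Y)) ⟨
  θ 𝕪 (B̄ (sing []) (θ b Y)) ++ θ b (B̄ y₁ Y) ∎
  where
  open ≐-Reasoning
  Z = lmulℓ (ℓ b) Y
  R : Letter → Letter → Poly
  R c d = neg (lmul (τ c) (lmul d Y))
  first : lmulℓ (sing 𝕪) (B̄ (sing []) Z) ≐ lmul 𝕪 Z
  first = ≐-trans (lin-sing (λ c → lmul c (B̄ (sing []) Z)) 𝕪) (linear-cong (lmul-linear 𝕪) (B̄-unitˡ Z))
  second : lmulℓ (ℓ b) (B̄ (lmulℓ (sing 𝕪) (sing [])) Y) ≐ θ b (B̄ y₁ Y)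
  second = ≐-trans (linear-cong (lmulℓ-linear (ℓ b)) (linear-cong (linearˡ B̄-bilinear Y) (lin-sing (λ c → lmul c (sing [])) 𝕪)))
                   (≐-sym (θ-ℓ b (noConst-B̄ Y (noConst-lmul 𝕪 (sing [])))))
  third : bilin R (sing 𝕪) (ℓ b) ≐ neg (lmul 𝕩 Z)
  third = ≐-trans (lin-sing (λ c → lin (R c) (ℓ b)) 𝕪)
                  (≐-sym (linear-lin (∘-linear neg-linear (lmul-linear 𝕩)) (λ d → lmul d Y) (ℓ b)))
  fourth : θ 𝕪 (B̄ (sing []) (θ b Y)) ≐ lmul 𝕪 Z ++ neg (lmul 𝕩 Z)
  fourth = ≐-trans (linear-cong (θ-linear 𝕪) (≐-trans (B̄-unitˡ (θ b Y)) (θ-ℓ b ncY)))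
                   (θ-σ₂ 𝕪 (noConst-cong (θ-ℓ b ncY) (noConst-θ b Y)))

θ-leibniz-Ny : (a : Letter) {X : Poly} → NoConst X →
  B̄ (θ a X) y₁ ≐ θ a (B̄ X y₁) ++ θ 𝕪 (B̄ (θ a X) (sing []))
θ-leibniz-Ny a {X} ncX = begin
  B̄ (θ a X) y₁
    ≈⟨ bilin-cong nshw (θ-ℓ a ncX) (≐-sym (lin-sing (λ d → lmul d (sing [])) 𝕪)) ⟩
  B̄ Z (lmulℓ (sing 𝕪) (sing []))
    ≈⟨ leibniz-extend nshw lmul lmul-linear lmul lmul-linear X (sing []) R
         (λ c d → shuffle-leibniz-letterʳ c d ncX) (ℓ a) (sing 𝕪) ⟩
  lmulℓ (ℓ a) (B̄ X (lmulℓ (sing 𝕪) (sing []))) ++ (lmulℓ (sing 𝕪) (B̄ Z (sing [])) ++ bilin R (ℓ a) (sing 𝕪))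
    ≈⟨ ++-cong first (++-cong second third) ⟩
  θ a (B̄ X y₁) ++ (lmul 𝕪 Z ++ neg (lmul 𝕩 Z))
    ≈⟨ ++-congʳ (θ a (B̄ X y₁)) fourth ⟨
  θ a (B̄ X y₁) ++ θ 𝕪 (B̄ (θ a X) (sing [])) ∎
  where
  open ≐-Reasoning
  Z = lmulℓ (ℓ a) X
  R : Letter → Letter → Poly
  R c d = neg (lmul (τ d) (lmul c X))
  first : lmulℓ (ℓ a) (B̄ X (lmulℓ (sing 𝕪) (sing []))) ≐ θ a (B̄ X y₁)
  first = ≐-trans (linear-cong (lmulℓ-linear (ℓ a)) (linear-cong (linearʳ B̄-bilinear X) (lin-sing (λ d → lmul d (sing [])) 𝕪)))
                  (≐-sym (θ-ℓ a (noConst-B̄ y₁ ncX)))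
  second : lmulℓ (sing 𝕪) (B̄ Z (sing [])) ≐ lmul 𝕪 Z
  second = ≐-trans (lin-sing (λ c → lmul c (B̄ Z (sing []))) 𝕪) (linear-cong (lmul-linear 𝕪) (B̄-unitʳ Z))
  third : bilin R (ℓ a) (sing 𝕪) ≐ neg (lmul 𝕩 Z)
  third = ≐-trans (lin-cong-fun (λ c → lin-sing (R c) 𝕪) (ℓ a))
                  (≐-sym (linear-lin (∘-linear neg-linear (lmul-linear 𝕩)) (λ c → lmul c X) (ℓ a)))
  fourth : θ 𝕪 (B̄ (θ a X) (sing [])) ≐ lmul 𝕪 Z ++ neg (lmul 𝕩 Z)
  fourth = ≐-trans (linear-cong (θ-linear 𝕪) (≐-trans (B̄-unitʳ (θ a X)) (θ-ℓ a ncX)))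
                   (θ-σ₂ 𝕪 (noConst-cong (θ-ℓ a ncX) (noConst-θ a X)))

θ-leibniz-yy : B̄ y₁ y₁ ≐ θ 𝕪 (B̄ (sing []) y₁) ++ θ 𝕪 (B̄ y₁ (sing []))
θ-leibniz-yy = begin
  B̄ y₁ y₁
    ≈⟨ bilin-sing nshw (𝕪 ∷ []) (𝕪 ∷ []) ⟩
  yy ++ (yy ++ (neg xy ++ neg xy))
    ≈⟨ lin-comb (v 0 ⊹ (v 0 ⊹ (⊟ v 1 ⊹ ⊟ v 1))) ((v 0 ⊹ ⊟ v 1) ⊹ (v 0 ⊹ ⊟ v 1)) (λ _ → refl) (yy ∷ xy ∷ []) ⟩
  (yy ++ neg xy) ++ (yy ++ neg xy)
    ≈⟨ ++-cong (linear-cong (θ-linear 𝕪) (B̄-unitˡ y₁)) (linear-cong (θ-linear 𝕪) (B̄-unitʳ y₁)) ⟨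
  θ 𝕪 (B̄ (sing []) y₁) ++ θ 𝕪 (B̄ y₁ (sing [])) ∎
  where
  open ≐-Reasoning
  yy = sing (𝕪 ∷ 𝕪 ∷ [])
  xy = sing (𝕩 ∷ 𝕪 ∷ [])

θ-leibniz : (a b : Letter) (u w : Word) → H1Word (a ∷ u) → H1Word (b ∷ w) →
  B̄ (θ a (S̃w u)) (θ b (S̃w w)) ≐ θ a (B̄ (S̃w u) (θ b (S̃w w))) ++ θ b (B̄ (θ a (S̃w u)) (S̃w w))
θ-leibniz a b [] [] hu hw with H1-letter a hu | H1-letter b hw
... | refl | refl = θ-leibniz-yy
θ-leibniz a b [] (d ∷ w) hu hw with H1-letter a hu
... | refl = θ-leibniz-yN b (noConst-S̃w d w)
θ-leibniz a b (c ∷ u) [] hu hw with H1-letter b hw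
... | refl = θ-leibniz-Ny a (noConst-S̃w c u)
θ-leibniz a b (c ∷ u) (d ∷ w) hu hw = θ-leibniz-NN a b (noConst-S̃w c u) (noConst-S̃w d w)

S̃-lmul : (a : Letter) (Z : Poly) → S̃ (lmul a Z) ≐ θ a (S̃ Z)
S̃-lmul a = lin-mapFS-hom S̃w S̃w (a ∷_) (θ-linear a) (S̃w-cons a)

S̃-shuffle-word : (u w : Word) → H1Word u → H1Word w → S̃ (shw u w) ≐ B̄ (S̃w u) (S̃w w)
S̃-shuffle-word [] w _ _ = ≐-trans (lin-sing S̃w w) (≐-sym (B̄-unitˡ (S̃w w)))
S̃-shuffle-word (a ∷ u) [] _ _ = ≐-trans (lin-sing S̃w (a ∷ u)) (≐-sym (B̄-unitʳ (S̃w (a ∷ u))))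
S̃-shuffle-word (a ∷ u) (b ∷ w) hu hw = begin
  S̃ (lmul a (shw u (b ∷ w)) ++ lmul b (shw (a ∷ u) w))
    ≈⟨ linear-++ (lin-linear S̃w) (lmul a (shw u (b ∷ w))) (lmul b (shw (a ∷ u) w)) ⟩
  S̃ (lmul a (shw u (b ∷ w))) ++ S̃ (lmul b (shw (a ∷ u) w))
    ≈⟨ ++-cong (S̃-lmul a (shw u (b ∷ w))) (S̃-lmul b (shw (a ∷ u) w)) ⟩
  θ a (S̃ (shw u (b ∷ w))) ++ θ b (S̃ (shw (a ∷ u) w))
    ≈⟨ ++-cong (linear-cong (θ-linear a) (S̃-shuffle-word u (b ∷ w) (H1-tail a u hu) hw))
               (linear-cong (θ-linear b) (S̃-shuffle-word (a ∷ u) w hu (H1-tail b w hw))) ⟩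
  θ a (B̄ (S̃w u) (S̃w (b ∷ w))) ++ θ b (B̄ (S̃w (a ∷ u)) (S̃w w))
    ≈⟨ ++-cong (linear-cong (∘-linear (θ-linear a) (linearʳ B̄-bilinear (S̃w u))) (S̃w-cons b w))
               (linear-cong (∘-linear (θ-linear b) (linearˡ B̄-bilinear (S̃w w))) (S̃w-cons a u)) ⟩
  θ a (B̄ (S̃w u) (θ b (S̃w w))) ++ θ b (B̄ (θ a (S̃w u)) (S̃w w))
    ≈⟨ θ-leibniz a b u w hu hw ⟨
  B̄ (θ a (S̃w u)) (θ b (S̃w w))
    ≈⟨ bilin-cong nshw (S̃w-cons a u) (S̃w-cons b w) ⟨
  B̄ (S̃w (a ∷ u)) (S̃w (b ∷ w)) ∎
  where open ≐-Reasoning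

S̃-shuffle : (p q : Poly) → InH1 p → InH1 q → S̃ (p ⧢ q) ≈ S̃ p ⧢̄ S̃ q
S̃-shuffle p q hp hq = begin
  S̃ (p ⧢ q)                                          ≈⟨ ≐⇒≈ (linear-bilin (lin-linear S̃w) shw p q) ⟩
  bilin (λ u w → S̃ (shw u w)) p q                    ≈⟨ bilin-on-H1 p q hp hq S̃-shuffle-word ⟩
  bilin (λ u w → B̄ (S̃w u) (S̃w w)) p q               ≈⟨ ≐⇒≈ (bilin-lin nshw S̃w S̃w p q) ⟨
  S̃ p ⧢̄ S̃ q                                          ∎
  where open ≈-Reasoning

lemma2p9 : ((p : Poly) → InH1 p → S̃ (S p) ≈ p)
         × ((p : Poly) → InH1 p → S (S̃ p) ≈ p)
         × ((p q : Poly) → InH1 p → InH1 q → S̃ (p ✶ q) ≈ S̃ p ✶̄ S̃ q)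
         × ((p q : Poly) → InH1 p → InH1 q → S̃ (p ⧢ q) ≈ S̃ p ⧢̄ S̃ q)
lemma2p9 = S̃∘S , S∘S̃ , S̃-harmonic , S̃-shuffle
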